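{- Let $0<\varepsilon<1$. For sufficiently large $n$, the quantity $$2\sum_{q=2}^{\min\{s,n-1\}}\sum_{c=0}^{n-q}\binom{n}{q}\binom{n-q}{c}\left(2^{n-c-q}-1\right)^c,\qquad s=\left\lceil 10\log\tfrac{1}{\varepsilon}+37\right\rceil,$$ is a $(1-\varepsilon)$-approximation of the number of labeled split graphs on vertex set $\{1,\dots,n\}$ whose questioning set $Q$ satisfies $2\le |Q|<n$.
   Context: A split graph is a graph whose vertex set can be partitioned into a clique and an independent set (parts may be empty); such an ordered pair (clique, independent set) is a split partition. The questioning set $Q$ of a split graph is the set of vertices $v$ for which some split partition places $v$ in the clique and some split partition places $v$ in the independent set. A number $A$ is a $(1-\varepsilon)$-approximation of $B$ if $B(1-\varepsilon)\le A\le B$. Here $\log$ denotes the base-2 logarithm.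
   Formalization: The parameter ε ranges over the rationals strictly between 0 and 1 rather than over the reals. -}

module Defs where

open import Data.Nat using (ℕ; zero; suc; _+_; _*_; _∸_; _^_; _≤_; _<_; _⊔_; _⊓_)
open import Data.Nat.Combinatorics using (_C_)
open import Data.Bool using (Bool; true; false)
open import Data.Fin using (Fin)
open import Data.Vec using (Vec; lookup)
open import Data.List using (List; length; map; upTo)
open import Data.Nat.ListAction using (sum)
open import Data.List.Membership.Propositional using (_∈_)
open import Data.List.Relation.Unary.Unique.Propositional using (Unique)
open import Data.Product using (Σ; _×_; ∃)
open import Function.Bundles using (_⇔_)
open import Relation.Binary.PropositionalEquality using (_≡_; _≢_)

Count : {A : Set} → (A → Set) → ℕ → Set
Count {A} P k = Σ (List A) λ L → Unique L × (∀ x → (x ∈ L) ⇔ P x) × length L ≡ k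

-- Adjacency matrices on vertex set Fin n (vertices 1..n of the paper).
Adj : ℕ → Set
Adj n = Vec (Vec Bool n) n

adj : ∀ {n} → Adj n → Fin n → Fin n → Bool
adj M i j = lookup (lookup M i) j

-- Labeled simple graph on Fin n: symmetric, irreflexive adjacency matrix
-- (each labeled graph corresponds to exactly one such matrix).
IsGraph : ∀ {n} → Adj n → Set
IsGraph {n} M = (∀ (i : Fin n) → adj M i i ≡ false) × (∀ (i j : Fin n) → adj M i j ≡ adj M j i)

-- A split partition, encoded by side : Fin n → Bool
-- (true = in the clique K, false = in the independent set I).
IsSplitPartition : ∀ {n} → Adj n → (Fin n → Bool) → Set
IsSplitPartition {n} M side =
  (∀ (i j : Fin n) → i ≢ j → side i ≡ true → side j ≡ true → adj M i j ≡ true) ×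
  (∀ (i j : Fin n) → side i ≡ false → side j ≡ false → adj M i j ≡ false)

IsSplitGraph : ∀ {n} → Adj n → Set
IsSplitGraph {n} M = IsGraph M × ∃ λ (side : Fin n → Bool) → IsSplitPartition M side

InQ : ∀ {n} → Adj n → Fin n → Set
InQ {n} M v =
  (∃ λ (side : Fin n → Bool) → IsSplitPartition M side × side v ≡ true) ×
  (∃ λ (side : Fin n → Bool) → IsSplitPartition M side × side v ≡ false)

Target : (n : ℕ) → Adj n → Set
Target n M = IsSplitGraph M × ∃ λ k → Count (InQ M) k × 2 ≤ k × k < n

-- sumFromTo a b f = Σ_{i=a}^{b} f i (empty when b < a).
sumFromTo : ℕ → ℕ → (ℕ → ℕ) → ℕ
sumFromTo a b f = sum (map (λ i → f (a + i)) (upTo (suc b ∸ a)))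

approx : ℕ → ℕ → ℕ
approx s n = 2 * sumFromTo 2 (s ⊓ (n ∸ 1)) λ q →
               sumFromTo 0 (n ∸ q) λ c →
                 (n C q) * ((n ∸ q) C c) * ((2 ^ (n ∸ c ∸ q) ∸ 1) ^ c)

-- For ε = p / d (0 < p < d): s = ⌈10 log₂(1/ε) + 37⌉, characterised as the
-- least natural k with 10 log₂(d/p) + 37 ≤ k, i.e. 37 ≤ k and d^10 ≤ p^10 2^(k-37).
CeilBound : ℕ → ℕ → ℕ → Set
CeilBound p d k = 37 ≤ k × d ^ 10 ≤ p ^ 10 * 2 ^ (k ∸ 37)

IsS : ℕ → ℕ → ℕ → Set
IsS p d s = CeilBound p d s × (∀ k → CeilBound p d k → s ≤ k)

-- A split graph with two questioning vertices has its questioning set Q either a clique or an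
-- independent set; complementation exchanges the two cases and preserves Q and splitness, which
-- gives the factor 2. When Q is a clique, the graph is determined by sorting the other vertices into
-- the rest K of the clique and the independent set I and by the K–I edges, every vertex of K having a
-- neighbour in I; conversely every such choice yields a split graph whose questioning set is exactly
-- Q. For |Q| = q and |K| = c there are C(n,q) C(n-q,c) (2^(n-q-c) - 1)^c choices, so the full double
-- sum over 2 ≤ q < n counts the target graphs exactly. As for the truncation, the summands with
-- c ≥ n/8 shrink by a factor n / 2^c or better when q grows by one, and those with c < n/8 are
-- negligible next to the single summand q = 2, c = n/4. Hence for large n the rows q ≥ 3 together
-- contribute at most 1/d ≤ ε times the row q = 2.

module Submission where

open import Defs
open import Data.Nat using (ℕ; zero; suc; _+_; _*_; _∸_; _^_; _≤_; _<_; _⊓_; z≤n; s≤s; NonZero; >-nonZero; _≤?_; _<?_; _/_)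
open import Data.Nat.Properties hiding (_≟_)
open import Data.Nat.Combinatorics using (_C_; nCk+nC[k+1]≡[n+1]C[k+1]; k>n⇒nCk≡0)
open import Data.Nat.DivMod using (m≡m%n+[m/n]*n; m%n<n; m/n*n≤m)
open import Data.Nat.ListAction using (sum)
open import Data.Nat.Tactic.RingSolver using (solve; solve-∀)
open import Algebra.Properties.CommutativeSemigroup +-commutativeSemigroup using (interchange)
open import Algebra.Properties.CommutativeSemigroup *-commutativeSemigroup using () renaming (interchange to *-interchange)
open import Data.Bool using (Bool; true; false; not; if_then_else_)
import Data.Bool.Properties as Bool
open import Data.Bool.Properties using (not-¬; ¬-not; not-involutive)
open import Data.Empty using (⊥; ⊥-elim)
open import Data.Fin using (Fin; _≟_)
import Data.Fin as Fin
import Data.Fin.Properties as Fin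
open import Data.Fin.Properties using (any?; all?; ¬∀⟶∃¬)
open import Data.List using (List; []; _∷_; _++_; map; length; filter; applyUpTo)
import Data.List as List
open import Data.List.Properties using (length-++; length-map; map-applyUpTo)
open import Data.List.Membership.Propositional using (_∈_)
open import Data.List.Membership.Propositional.Properties using (∈-map⁺; ∈-map⁻; ++-∈⇔; ∈-filter⁺; ∈-filter⁻)
open import Data.List.Membership.Propositional.Properties.WithK using (unique∧set⇒bag)
open import Data.List.Relation.Binary.BagAndSetEquality using (∼bag⇒↭)
open import Data.List.Relation.Binary.Permutation.Propositional.Properties using (↭-length)
import Data.List.Relation.Unary.All as All
import Data.List.Relation.Unary.All.Properties as All
open import Data.List.Relation.Unary.AllPairs using ([]; _∷_)
open import Data.List.Relation.Unary.Any using (here; there)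
open import Data.List.Relation.Unary.Unique.Propositional using (Unique)
import Data.List.Relation.Unary.Unique.Propositional.Properties as Unique
open import Data.Product using (Σ; _×_; _,_; proj₁; proj₂; ∃; uncurry)
import Data.Product as Product
open import Data.Sum using (_⊎_; inj₁; inj₂; [_,_])
import Data.Sum as Sum
open import Data.Unit using (⊤; tt)
open import Data.Vec using (Vec; []; _∷_; lookup; tabulate; replicate)
import Data.Vec as Vec
open import Data.Vec.Properties using (∷-injective; ∷-injectiveʳ; ≡-dec; lookup∘tabulate; tabulate∘lookup; tabulate-cong; lookup-replicate)
open import Data.Vec.Functional using (updateAt)
open import Data.Vec.Functional.Properties using (updateAt-updates; updateAt-minimal)
open import Data.Vec.Relation.Binary.Pointwise.Inductive using (Pointwise; []; _∷_)
import Data.Vec.Relation.Binary.Pointwise.Inductive as Pointwise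
open import Function.Base using (_∘_; id; const; case_of_)
open import Function.Bundles using (_⇔_; mk⇔; Equivalence)
import Function.Properties.Equivalence as ⇔
open import Relation.Nullary using (¬_; Dec; yes; no; does)
open import Relation.Nullary.Decidable using (_×-dec_; _→-dec_; ¬?; toWitness)
open import Relation.Unary using (Decidable)
open import Relation.Binary.Definitions using (DecidableEquality)
open import Relation.Binary.PropositionalEquality using (_≡_; _≢_; refl; sym; trans; cong; cong₂; subst; module ≡-Reasoning)

open Equivalence using (to; from)

private variable
  A B : Set
  P P′ : A → Set
  a b c n : ℕ

∑ : ℕ → (ℕ → ℕ) → ℕ
∑ len f = sum (applyUpTo f len)

syntax ∑ len (λ i → e) = ∑[ i < len ] e

∑-cong : ∀ len {f g : ℕ → ℕ} → (∀ i → f i ≡ g i) → ∑ len f ≡ ∑ len g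
∑-cong zero f≗g = refl
∑-cong (suc len) f≗g = cong₂ _+_ (f≗g 0) (∑-cong len (f≗g ∘ suc))

sumFromTo≡∑ : ∀ a b f → sumFromTo a b f ≡ ∑[ i < suc b ∸ a ] f (a + i)
sumFromTo≡∑ a b f = cong sum (map-applyUpTo id (λ i → f (a + i)) (suc b ∸ a))

∑-split : ∀ a b (f : ℕ → ℕ) → ∑ (a + b) f ≡ ∑ a f + ∑[ i < b ] f (a + i)
∑-split zero b f = refl
∑-split (suc a) b f = trans (cong (f 0 +_) (∑-split a b (f ∘ suc))) (sym (+-assoc (f 0) _ _))

∑-mono : ∀ len {f g : ℕ → ℕ} → (∀ i → f i ≤ g i) → ∑ len f ≤ ∑ len g
∑-mono zero f≤g = z≤n
∑-mono (suc len) f≤g = +-mono-≤ (f≤g 0) (∑-mono len (f≤g ∘ suc))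

∑-+ : ∀ len (f g : ℕ → ℕ) → ∑[ i < len ] (f i + g i) ≡ ∑ len f + ∑ len g
∑-+ zero f g = refl
∑-+ (suc len) f g = trans (cong (f 0 + g 0 +_) (∑-+ len (f ∘ suc) (g ∘ suc))) (interchange (f 0) (g 0) _ _)

∑-*ʳ : ∀ len (f : ℕ → ℕ) k → ∑ len f * k ≡ ∑[ i < len ] (f i * k)
∑-*ʳ zero f k = refl
∑-*ʳ (suc len) f k = trans (*-distribʳ-+ k (f 0) _) (cong (f 0 * k +_) (∑-*ʳ len (f ∘ suc) k))

∑-≤-* : ∀ len (f : ℕ → ℕ) {K} → (∀ i → i < len → f i ≤ K) → ∑ len f ≤ len * K
∑-≤-* zero f _ = z≤n
∑-≤-* (suc len) f f≤K = +-mono-≤ (f≤K 0 (s≤s z≤n)) (∑-≤-* len (f ∘ suc) λ i i<len → f≤K (suc i) (s≤s i<len))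

term≤∑ : ∀ len (f : ℕ → ℕ) {i} → i < len → f i ≤ ∑ len f
term≤∑ (suc len) f {zero} _ = m≤m+n (f 0) _
term≤∑ (suc len) f {suc i} (s≤s i<len) = ≤-trans (term≤∑ len (f ∘ suc) i<len) (m≤n+m _ (f 0))

∑-prefix : ∀ {a b} (f : ℕ → ℕ) → a ≤ b → ∑ a f ≤ ∑ b f
∑-prefix {a} {b} f a≤b = begin
  ∑ a f                               ≤⟨ m≤m+n (∑ a f) _ ⟩
  ∑ a f + ∑[ i < b ∸ a ] f (a + i)    ≡⟨ sym (∑-split a (b ∸ a) f) ⟩
  ∑ (a + (b ∸ a)) f                   ≡⟨ cong (λ m → ∑ m f) (m+[n∸m]≡n a≤b) ⟩
  ∑ b f                               ∎
  where open ≤-Reasoning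

∑-vanishing : ∀ a b (f : ℕ → ℕ) → (∀ i → f (a + i) ≡ 0) → ∑ (a + b) f ≡ ∑ a f
∑-vanishing a b f vanish = begin-equality
  ∑ (a + b) f                      ≡⟨ ∑-split a b f ⟩
  ∑ a f + ∑[ i < b ] f (a + i)     ≡⟨ cong (∑ a f +_) (∑-cong b vanish) ⟩
  ∑ a f + ∑[ i < b ] 0             ≡⟨ cong (∑ a f +_) (zeros b) ⟩
  ∑ a f + 0                        ≡⟨ +-identityʳ _ ⟩
  ∑ a f                            ∎
  where
  open ≤-Reasoning
  zeros : ∀ b → ∑[ i < b ] 0 ≡ 0
  zeros zero = refl
  zeros (suc b) = zeros b

∑-geometric : (f : ℕ → ℕ) → (∀ q → f (suc q) * 2 ≤ f q) → ∀ a b → ∑[ i < b ] f (a + i) ≤ 2 * f a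
∑-geometric f halving a zero = z≤n
∑-geometric f halving a (suc b) = begin
  f (a + 0) + ∑[ i < b ] f (a + suc i)  ≡⟨ cong₂ _+_ (cong f (+-identityʳ a)) (∑-cong b λ i → cong f (+-suc a i)) ⟩
  f a + ∑[ i < b ] f (suc a + i)        ≤⟨ +-monoʳ-≤ (f a) (∑-geometric f halving (suc a) b) ⟩
  f a + 2 * f (suc a)                   ≤⟨ +-monoʳ-≤ (f a) (subst (_≤ f a) (*-comm (f (suc a)) 2) (halving a)) ⟩
  f a + f a                             ≡⟨ cong (f a +_) (sym (+-identityʳ (f a))) ⟩
  2 * f a                               ∎
  where open ≤-Reasoning


-- Counting with duplicate-free lists

Count-cong : (∀ x → P x ⇔ P′ x) → Count P c → Count P′ c
Count-cong P⇔P′ (L , u , mem , len) = L , u , (λ x → ⇔.trans (mem x) (P⇔P′ x)) , len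

Count-unique : Count P a → Count P b → a ≡ b
Count-unique (L , u , mem , refl) (L′ , u′ , mem′ , refl) =
  ↭-length (∼bag⇒↭ (unique∧set⇒bag u u′ λ {x} → ⇔.trans (mem x) (⇔.sym (mem′ x))))

Count-empty : (∀ x → ¬ P x) → Count P 0
Count-empty ¬P = [] , [] , (λ x → mk⇔ (λ ()) (⊥-elim ∘ ¬P x)) , refl

Count-singleton : (x : A) → Count (_≡ x) 1
Count-singleton x = x ∷ [] , All.[] ∷ [] , (λ y → mk⇔ (λ { (here y≡x) → y≡x ; (there ()) }) (λ y≡x → here y≡x)) , refl

Count-⊎ : (∀ x → P x → P′ x → ⊥) → Count P a → Count P′ b → Count (λ x → P x ⊎ P′ x) (a + b)
Count-⊎ disjoint (L , u , mem , refl) (L′ , u′ , mem′ , refl) =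
  L ++ L′ , Unique.++⁺ u u′ (λ (x∈L , x∈L′) → disjoint _ (to (mem _) x∈L) (to (mem′ _) x∈L′)) ,
  (λ x → ⇔.trans ++-∈⇔ (mk⇔ (Sum.map (to (mem x)) (to (mem′ x))) (Sum.map (from (mem x)) (from (mem′ x))))) ,
  length-++ L

-- Unique.map⁺ needs f to be injective everywhere, not just on the list.
private
  map⁺-on : {f : A → B} {xs : List A} → (∀ {x y} → x ∈ xs → y ∈ xs → f x ≡ f y → x ≡ y) →
            Unique xs → Unique (map f xs)
  map⁺-on inj [] = []
  map⁺-on inj (x∉ ∷ u) =
    All.map⁺ (All.tabulate λ y∈ fx≡fy → All.lookup x∉ y∈ (inj (here refl) (there y∈) fx≡fy)) ∷
    map⁺-on (λ x∈ y∈ → inj (there x∈) (there y∈)) u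

Count-image : (f : A → B) → (∀ {x y} → P x → P y → f x ≡ f y → x ≡ y) →
              Count P c → Count (λ y → ∃ λ x → P x × y ≡ f x) c
Count-image f inj (L , u , mem , refl) =
  map f L ,
  map⁺-on (λ x∈ y∈ → inj (to (mem _) x∈) (to (mem _) y∈)) u ,
  (λ y → mk⇔ (λ y∈ → let (x , x∈ , y≡) = ∈-map⁻ f y∈ in x , to (mem x) x∈ , y≡)
             (λ { (x , Px , refl) → ∈-map⁺ f (from (mem x) Px) })) ,
  length-map f L

Count-filter : Decidable P′ → Count P a → ∃ λ c → Count (λ x → P x × P′ x) c
Count-filter P′? (L , u , mem , _) =
  _ , filter P′? L , Unique.filter⁺ P′? u ,
  (λ x → mk⇔ (λ x∈ → let (x∈L , P′x) = ∈-filter⁻ P′? x∈ in to (mem x) x∈L , P′x)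
             (λ (Px , P′x) → ∈-filter⁺ P′? (from (mem x) Px) P′x)) ,
  refl

Count-∖ : Decidable P′ → Count P a → Count (λ x → P x × P′ x) b → Count (λ x → P x × ¬ P′ x) (a ∸ b)
Count-∖ {P′ = P′} {P = P} {a = a} {b = b} P′? count-P count-P∩P′ with Count-filter (¬? ∘ P′?) count-P
... | m , count-P∖P′ = subst (Count _) m≡a∸b count-P∖P′
  where
  split : ∀ x → ((P x × P′ x) ⊎ (P x × ¬ P′ x)) ⇔ P x
  split x = mk⇔ (λ { (inj₁ (Px , _)) → Px ; (inj₂ (Px , _)) → Px })
                (λ Px → case P′? x of λ { (yes P′x) → inj₁ (Px , P′x) ; (no ¬P′x) → inj₂ (Px , ¬P′x) })
  b+m≡a : b + m ≡ a
  b+m≡a = Count-unique (Count-cong split (Count-⊎ (λ _ (_ , P′x) (_ , ¬P′x) → ¬P′x P′x) count-P∩P′ count-P∖P′)) count-P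
  m≡a∸b : m ≡ a ∸ b
  m≡a∸b = trans (sym (m+n∸m≡n b m)) (cong (_∸ b) b+m≡a)

Count-Σ : {Q : A → B → Set} → Count P a → (∀ x → P x → Count (Q x) b) →
          Count (λ (x , y) → P x × Q x y) (a * b)
Count-Σ {A = A} {b = b} {Q = Q} (L , u , mem , refl) count-Q =
  Count-cong (λ (x , y) → mk⇔ (Product.map₁ (to (mem x))) (Product.map₁ (from (mem x))))
    (over L u λ x x∈ → count-Q x (to (mem x) x∈))
  where
  over : (L : List A) → Unique L → (∀ x → x ∈ L → Count (Q x) b) →
         Count (λ (x , y) → x ∈ L × Q x y) (length L * b)
  over [] _ _ = Count-empty λ { _ (() , _) }
  over (x ∷ L) (x∉L ∷ u) count =
    Count-cong split (Count-⊎ disjoint (Count-image (x ,_) (λ _ _ → cong proj₂) (count x (here refl)))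
                                        (over L u λ z z∈ → count z (there z∈)))
    where
    disjoint : ∀ p → (∃ λ y → Q x y × p ≡ (x , y)) → proj₁ p ∈ L × Q (proj₁ p) (proj₂ p) → ⊥
    disjoint _ (_ , _ , refl) (x∈L , _) = All.lookup x∉L x∈L refl
    split : ∀ p → ((∃ λ y → Q x y × p ≡ (x , y)) ⊎ (proj₁ p ∈ L × Q (proj₁ p) (proj₂ p))) ⇔
                  (proj₁ p ∈ x ∷ L × Q (proj₁ p) (proj₂ p))
    split p = mk⇔ (λ { (inj₁ (_ , Qxy , refl)) → here refl , Qxy ; (inj₂ (z∈ , Qzy)) → there z∈ , Qzy })
                  (λ { (here refl , Qxy) → inj₁ (_ , Qxy , refl) ; (there z∈ , Qzy) → inj₂ (z∈ , Qzy) })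

Count-× : Count P a → Count P′ b → Count (λ (x , y) → P x × P′ y) (a * b)
Count-× count-P count-P′ = Count-Σ count-P λ _ _ → count-P′

Count-two : Count P c → 2 ≤ c → ∃ λ x → ∃ λ y → x ≢ y × P x × P y
Count-two (x ∷ y ∷ _ , (x∉ ∷ _) , mem , _) _ =
  x , y , All.lookup x∉ (here refl) , to (mem x) (here refl) , to (mem y) (there (here refl))
Count-two ([] , _ , _ , refl) ()
Count-two (_ ∷ [] , _ , _ , refl) (s≤s ())

Count-range : (φ : A → ℕ) {f : ℕ → ℕ} → (∀ i → Count (λ x → P x × φ x ≡ i) (f i)) →
              ∀ a len → Count (λ x → P x × a ≤ φ x × φ x < a + len) (∑[ i < len ] f (a + i))
Count-range φ fibre a zero =
  Count-empty λ x (_ , a≤φx , φx<a+0) → <-irrefl refl (≤-trans φx<a+0 (subst (_≤ φ x) (sym (+-identityʳ a)) a≤φx))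
Count-range {P = P} φ {f} fibre a (suc len) =
  Count-cong split (Count-⊎ disjoint (subst (Count _) (cong f (sym (+-identityʳ a))) (fibre a))
    (subst (Count _) (∑-cong len λ i → cong f (sym (+-suc a i))) (Count-range φ fibre (suc a) len)))
  where
  disjoint : ∀ x → P x × φ x ≡ a → P x × suc a ≤ φ x × φ x < suc a + len → ⊥
  disjoint x (_ , refl) (_ , a<a , _) = <-irrefl refl a<a
  split : ∀ x → ((P x × φ x ≡ a) ⊎ (P x × suc a ≤ φ x × φ x < suc a + len)) ⇔ (P x × a ≤ φ x × φ x < a + suc len)
  split x = mk⇔
    (λ { (inj₁ (Px , refl)) → Px , ≤-refl , subst (a <_) (sym (+-suc a len)) (s≤s (m≤m+n a len))
       ; (inj₂ (Px , a<φx , φx<)) → Px , <⇒≤ a<φx , subst (φ x <_) (sym (+-suc a len)) φx< })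
    (λ (Px , a≤φx , φx<) → case m≤n⇒m<n∨m≡n a≤φx of λ
       { (inj₁ a<φx) → inj₂ (Px , a<φx , subst (φ x <_) (+-suc a len) φx<)
       ; (inj₂ a≡φx) → inj₁ (Px , sym a≡φx) })

module _ {R : B → A → Set} where

  Count-Pointwise-[] : Count {Vec A 0} (Pointwise R []) 1
  Count-Pointwise-[] = Count-cong (λ { [] → mk⇔ (λ _ → []) (λ _ → refl) }) (Count-singleton ([] {A = A}))

  Count-Pointwise-∷ : ∀ {b n} {bs : Vec B n} → Count (R b) a → Count {Vec A n} (Pointwise R bs) c →
                      Count {Vec A (suc n)} (Pointwise R (b ∷ bs)) (a * c)
  Count-Pointwise-∷ count-R count-Rs =
    Count-cong (λ { (x ∷ xs) → mk⇔ (λ { (_ , (Rx , Rxs) , refl) → Rx ∷ Rxs }) (λ { (Rx ∷ Rxs) → (x , xs) , (Rx , Rxs) , refl }) })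
      (Count-image (λ (x , xs) → x ∷ xs) (λ _ _ → uncurry (cong₂ _,_) ∘ ∷-injective) (Count-× count-R count-Rs))

data Role : Set where
  Q K I : Role

_≟ᴿ_ : DecidableEquality Role
Q ≟ᴿ Q = yes refl
K ≟ᴿ K = yes refl
I ≟ᴿ I = yes refl
Q ≟ᴿ K = no λ ()
Q ≟ᴿ I = no λ ()
K ≟ᴿ Q = no λ ()
K ≟ᴿ I = no λ ()
I ≟ᴿ Q = no λ ()
I ≟ᴿ K = no λ ()

count : Role → ∀ {n} → Vec Role n → ℕ
count x = Vec.count (_≟ᴿ x)

Count-byHead : {P : Vec Role (suc n) → Set} {a b c : ℕ} →
               Count (P ∘ (Q ∷_)) a → Count (P ∘ (K ∷_)) b → Count (P ∘ (I ∷_)) c → Count P (a + (b + c))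
Count-byHead {n} {P} count-Q count-K count-I =
  Count-cong split (Count-⊎ disjoint₁ (Count-image (Q ∷_) inj count-Q)
                     (Count-⊎ disjoint₂ (Count-image (K ∷_) inj count-K) (Count-image (I ∷_) inj count-I)))
  where
  inj : ∀ {x} {r s : Vec Role n} → P (x ∷ r) → P (x ∷ s) → x ∷ r ≡ x ∷ s → r ≡ s
  inj _ _ = ∷-injectiveʳ
  Image : Role → Vec Role (suc n) → Set
  Image x v = ∃ λ r → P (x ∷ r) × v ≡ x ∷ r
  disjoint₁ : ∀ v → Image Q v → Image K v ⊎ Image I v → ⊥
  disjoint₁ _ (_ , _ , refl) (inj₁ (_ , _ , ()))
  disjoint₁ _ (_ , _ , refl) (inj₂ (_ , _ , ()))
  disjoint₂ : ∀ v → Image K v → Image I v → ⊥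
  disjoint₂ _ (_ , _ , refl) (_ , _ , ())
  byHead : ∀ v → P v → Image Q v ⊎ (Image K v ⊎ Image I v)
  byHead (Q ∷ r) p = inj₁ (r , p , refl)
  byHead (K ∷ r) p = inj₂ (inj₁ (r , p , refl))
  byHead (I ∷ r) p = inj₂ (inj₂ (r , p , refl))
  split : ∀ v → (Image Q v ⊎ (Image K v ⊎ Image I v)) ⇔ P v
  split v = mk⇔ (λ { (inj₁ (_ , p , refl)) → p ; (inj₂ (inj₁ (_ , p , refl))) → p ; (inj₂ (inj₂ (_ , p , refl))) → p })
                (byHead v)

startingWithQ startingWithK : ℕ → ℕ → ℕ → ℕ
startingWithQ n zero    c = 0
startingWithQ n (suc q) c = (n C q) * ((n ∸ q) C c)
startingWithK n q zero    = 0
startingWithK n q (suc c) = (n C q) * ((n ∸ q) C c)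

pascal : ∀ n k → suc n C suc k ≡ n C k + n C suc k
pascal n k = sym (nCk+nC[k+1]≡[n+1]C[k+1] n k)

roles-pascal : ∀ n q c → startingWithQ n q c + (startingWithK n q c + (n C q) * ((n ∸ q) C c)) ≡
                         (suc n C q) * ((suc n ∸ q) C c)
roles-pascal n zero zero = refl
roles-pascal n zero (suc c) = begin
  (n C 0) * (n C c) + (n C 0) * (n C suc c) ≡⟨ sym (*-distribˡ-+ (n C 0) (n C c) (n C suc c)) ⟩
  (n C 0) * (n C c + n C suc c)             ≡⟨ cong ((n C 0) *_) (sym (pascal n c)) ⟩
  (n C 0) * (suc n C suc c)                 ∎
  where open ≡-Reasoning
roles-pascal n (suc q) zero = begin
  (n C q) * 1 + (0 + (n C suc q) * 1) ≡⟨ sym (*-distribʳ-+ 1 (n C q) (n C suc q)) ⟩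
  (n C q + n C suc q) * 1             ≡⟨ cong (_* 1) (sym (pascal n q)) ⟩
  (suc n C suc q) * 1                 ∎
  where open ≡-Reasoning
roles-pascal n (suc q) (suc c) = begin
  (n C q) * X + ((n C suc q) * ((n ∸ suc q) C c) + (n C suc q) * ((n ∸ suc q) C suc c))
    ≡⟨ cong ((n C q) * X +_) (sym (*-distribˡ-+ (n C suc q) _ _)) ⟩
  (n C q) * X + (n C suc q) * ((n ∸ suc q) C c + (n ∸ suc q) C suc c)
    ≡⟨ cong ((n C q) * X +_) shrink ⟩
  (n C q) * X + (n C suc q) * X
    ≡⟨ sym (*-distribʳ-+ X (n C q) (n C suc q)) ⟩
  (n C q + n C suc q) * X
    ≡⟨ cong (_* X) (sym (pascal n q)) ⟩
  (suc n C suc q) * X ∎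
  where
  open ≡-Reasoning
  X = (n ∸ q) C suc c
  shrink : (n C suc q) * ((n ∸ suc q) C c + (n ∸ suc q) C suc c) ≡ (n C suc q) * X
  shrink with q <? n
  ... | yes q<n = cong ((n C suc q) *_) (trans (sym (pascal (n ∸ suc q) c)) (cong (_C suc c) (sym (+-∸-assoc 1 q<n))))
  ... | no q≮n = trans (cong (_* ((n ∸ suc q) C c + (n ∸ suc q) C suc c)) nC[1+q]≡0) (sym (cong (_* X) nC[1+q]≡0))
    where
    nC[1+q]≡0 : n C suc q ≡ 0
    nC[1+q]≡0 = k>n⇒nCk≡0 (s≤s (≮⇒≥ q≮n))

Count-roles : ∀ n q c → Count (λ (r : Vec Role n) → count Q r ≡ q × count K r ≡ c) ((n C q) * ((n ∸ q) C c))
Count-roles zero zero zero = Count-cong (λ { [] → mk⇔ (λ _ → refl , refl) (λ _ → refl) }) (Count-singleton [])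
Count-roles zero zero (suc c) = Count-empty λ { [] (_ , ()) }
Count-roles zero (suc q) c = Count-empty λ { [] (() , _) }
Count-roles (suc n) q c = subst (Count _) (roles-pascal n q c) (Count-byHead (headQ q) (headK c) (Count-roles n q c))
  where
  headQ : ∀ q → Count (λ r → suc (count Q r) ≡ q × count K r ≡ c) (startingWithQ n q c)
  headQ zero = Count-empty λ { _ (() , _) }
  headQ (suc q) = Count-cong (λ r → mk⇔ (Product.map₁ (cong suc)) (Product.map₁ suc-injective)) (Count-roles n q c)
  headK : ∀ c → Count (λ r → count Q r ≡ q × suc (count K r) ≡ c) (startingWithK n q c)
  headK zero = Count-empty λ { _ (_ , ()) }
  headK (suc c) = Count-cong (λ r → mk⇔ (Product.map₂ (cong suc)) (Product.map₂ suc-injective)) (Count-roles n q c)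

Count-positions : ∀ x (r : Vec Role n) → Count (λ v → lookup r v ≡ x) (count x r)
Count-positions x [] = Count-empty λ ()
Count-positions x (y ∷ r) with y ≟ᴿ x
... | yes refl = Count-cong split (Count-⊎ disjoint (Count-singleton Fin.zero)
                                                  (Count-image Fin.suc (λ _ _ → Fin.suc-injective) (Count-positions x r)))
  where
  disjoint : ∀ v → v ≡ Fin.zero → (∃ λ w → lookup r w ≡ x × v ≡ Fin.suc w) → ⊥
  disjoint _ refl (_ , _ , ())
  split : ∀ v → (v ≡ Fin.zero ⊎ (∃ λ w → lookup r w ≡ x × v ≡ Fin.suc w)) ⇔ lookup (x ∷ r) v ≡ x
  split Fin.zero = mk⇔ (λ _ → refl) (λ _ → inj₁ refl)
  split (Fin.suc v) = mk⇔ (λ { (inj₂ (_ , rv≡x , refl)) → rv≡x }) (λ rv≡x → inj₂ (v , rv≡x , refl))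
... | no y≢x = Count-cong split (Count-image Fin.suc (λ _ _ → Fin.suc-injective) (Count-positions x r))
  where
  split : ∀ v → (∃ λ w → lookup r w ≡ x × v ≡ Fin.suc w) ⇔ lookup (y ∷ r) v ≡ x
  split Fin.zero = mk⇔ (λ { (_ , _ , ()) }) (⊥-elim ∘ y≢x)
  split (Fin.suc v) = mk⇔ (λ { (_ , rv≡x , refl) → rv≡x }) (λ rv≡x → v , rv≡x , refl)

count-total : (r : Vec Role n) → count Q r + count K r + count I r ≡ n
count-total [] = refl
count-total (Q ∷ r) = cong suc (count-total r)
count-total (K ∷ r) = trans (cong (_+ count I r) (+-suc (count Q r) (count K r))) (cong suc (count-total r))
count-total (I ∷ r) = trans (+-suc (count Q r + count K r) (count I r)) (cong suc (count-total r))

count-I : (r : Vec Role n) → count I r ≡ n ∸ count K r ∸ count Q r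
count-I {n} r = begin
  count I r                               ≡⟨ sym (m+n∸m≡n (count K r + count Q r) (count I r)) ⟩
  count K r + count Q r + count I r ∸ (count K r + count Q r)
    ≡⟨ cong (λ m → m + count I r ∸ (count K r + count Q r)) (+-comm (count K r) (count Q r)) ⟩
  count Q r + count K r + count I r ∸ (count K r + count Q r)
    ≡⟨ cong (_∸ (count K r + count Q r)) (count-total r) ⟩
  n ∸ (count K r + count Q r)             ≡⟨ sym (∸-+-assoc n (count K r) (count Q r)) ⟩
  n ∸ count K r ∸ count Q r               ∎
  where open ≡-Reasoning

count-K≤ : (r : Vec Role n) → count K r ≤ n ∸ count Q r
count-K≤ {n} r = subst (λ m → count K r ≤ m ∸ count Q r) (count-total r)
  (subst (count K r ≤_) (sym (trans (cong (_∸ count Q r) (+-assoc (count Q r) (count K r) (count I r)))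
                                    (m+n∸m≡n (count Q r) (count K r + count I r))))
         (m≤m+n (count K r) (count I r)))

-- A configuration (r , E) encodes a split graph in which Q is a clique: r puts each vertex into Q, into
-- the rest K of the clique, or into the independent set I, and row i of E lists the I-neighbours of a
-- vertex i ∈ K. That row must be nonempty, for otherwise i would be questioning as well.
Config : ℕ → Set
Config n = Vec Role n × Adj n

Allowed : Role → Bool → Set
Allowed Q b = b ≡ false
Allowed K b = b ≡ false
Allowed I b = ⊤

SupportedOnI : Vec Role n → Vec Bool n → Set
SupportedOnI = Pointwise Allowed

falses : Vec Bool n
falses = replicate _ false

KRow : Vec Role n → Vec Bool n → Set
KRow r row = SupportedOnI r row × row ≢ falses

RowOf : Vec Role n → Role → Vec Bool n → Set
RowOf r Q row = row ≡ falses
RowOf r K row = KRow r row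
RowOf r I row = row ≡ falses

ValidEdges : Vec Role n → Adj n → Set
ValidEdges r = Pointwise (RowOf r) r

falses-supportedOnI : (r : Vec Role n) → SupportedOnI r falses
falses-supportedOnI [] = []
falses-supportedOnI (Q ∷ r) = refl ∷ falses-supportedOnI r
falses-supportedOnI (K ∷ r) = refl ∷ falses-supportedOnI r
falses-supportedOnI (I ∷ r) = tt ∷ falses-supportedOnI r

Count-Bool : Count {Bool} (λ _ → ⊤) 2
Count-Bool = Count-cong (λ b → mk⇔ _ (λ _ → split b))
                        (Count-⊎ (λ { _ refl () }) (Count-singleton false) (Count-singleton true))
  where
  split : ∀ b → b ≡ false ⊎ b ≡ true
  split false = inj₁ refl
  split true = inj₂ refl

Count-supportedOnI : (r : Vec Role n) → Count (SupportedOnI r) (2 ^ count I r)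
Count-supportedOnI [] = Count-Pointwise-[]
Count-supportedOnI (Q ∷ r) = subst (Count _) (+-identityʳ _) (Count-Pointwise-∷ (Count-singleton false) (Count-supportedOnI r))
Count-supportedOnI (K ∷ r) = subst (Count _) (+-identityʳ _) (Count-Pointwise-∷ (Count-singleton false) (Count-supportedOnI r))
Count-supportedOnI (I ∷ r) = Count-Pointwise-∷ Count-Bool (Count-supportedOnI r)

Count-KRow : (r : Vec Role n) → Count (KRow r) (2 ^ count I r ∸ 1)
Count-KRow r = Count-∖ (λ row → ≡-dec Bool._≟_ row falses) (Count-supportedOnI r)
  (Count-cong (λ row → mk⇔ (λ { refl → falses-supportedOnI r , refl }) proj₂) (Count-singleton falses))

Count-validEdges : (r : Vec Role n) → Count (ValidEdges r) ((2 ^ count I r ∸ 1) ^ count K r)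
Count-validEdges {n} r = rows r
  where
  rows : ∀ {m} (s : Vec Role m) → Count {Vec (Vec Bool n) m} (Pointwise (RowOf r) s) ((2 ^ count I r ∸ 1) ^ count K s)
  rows [] = Count-Pointwise-[]
  rows (Q ∷ s) = subst (Count _) (+-identityʳ _) (Count-Pointwise-∷ (Count-singleton falses) (rows s))
  rows (K ∷ s) = Count-Pointwise-∷ (Count-KRow r) (rows s)
  rows (I ∷ s) = subst (Count _) (+-identityʳ _) (Count-Pointwise-∷ (Count-singleton falses) (rows s))

summand : ℕ → ℕ → ℕ → ℕ
summand n q c = (n C q) * ((n ∸ q) C c) * ((2 ^ (n ∸ c ∸ q) ∸ 1) ^ c)

Count-configs : ∀ n q c → Count (λ ((r , E) : Config n) → (count Q r ≡ q × count K r ≡ c) × ValidEdges r E) (summand n q c)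
Count-configs n q c = Count-Σ (Count-roles n q c) λ { r (refl , refl) →
  subst (λ m → Count (ValidEdges r) ((2 ^ m ∸ 1) ^ count K r)) (count-I r) (Count-validEdges r) }

Count-configsWithQ : ∀ n q → Count (λ ((r , E) : Config n) → count Q r ≡ q × ValidEdges r E)
                                   (sumFromTo 0 (n ∸ q) (summand n q))
Count-configsWithQ n q =
  subst (Count _) (sym (sumFromTo≡∑ 0 (n ∸ q) (summand n q)))
    (Count-cong inRange (Count-range (count K ∘ proj₁) fibre 0 (suc (n ∸ q))))
  where
  fibre : ∀ c → Count (λ ((r , E) : Config n) → (count Q r ≡ q × ValidEdges r E) × count K r ≡ c) (summand n q c)
  fibre c = Count-cong (λ _ → mk⇔ (λ ((q≡ , c≡) , V) → (q≡ , V) , c≡) (λ ((q≡ , V) , c≡) → (q≡ , c≡) , V))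
                       (Count-configs n q c)
  inRange : ∀ ((r , E) : Config n) → ((count Q r ≡ q × ValidEdges r E) × 0 ≤ count K r × count K r < suc (n ∸ q)) ⇔
                                     (count Q r ≡ q × ValidEdges r E)
  inRange (r , E) = mk⇔ proj₁ λ { (refl , V) → (refl , V) , z≤n , s≤s (count-K≤ r) }

Count-targetConfigs : ∀ n → Count (λ ((r , E) : Config n) → ValidEdges r E × 2 ≤ count Q r × count Q r < n)
                                  (sumFromTo 2 (n ∸ 1) λ q → sumFromTo 0 (n ∸ q) (summand n q))
Count-targetConfigs n =
  subst (Count _) (sym (sumFromTo≡∑ 2 (n ∸ 1) λ q → sumFromTo 0 (n ∸ q) (summand n q)))
    (Count-cong (λ (r , _) → below n (count Q r)) (Count-range (count Q ∘ proj₁) fibre 2 (suc (n ∸ 1) ∸ 2)))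
  where
  fibre : ∀ q → Count (λ ((r , E) : Config n) → ValidEdges r E × count Q r ≡ q) (sumFromTo 0 (n ∸ q) (summand n q))
  fibre q = Count-cong (λ _ → mk⇔ Product.swap Product.swap) (Count-configsWithQ n q)
  below : ∀ {V : Set} n m → (V × 2 ≤ m × m < 2 + (suc (n ∸ 1) ∸ 2)) ⇔ (V × 2 ≤ m × m < n)
  below zero m = mk⇔ (λ { (_ , 2≤m , m<2) → ⊥-elim (<-irrefl refl (≤-trans m<2 2≤m)) }) (λ { (_ , _ , ()) })
  below (suc zero) m = mk⇔ (λ { (_ , 2≤m , m<2) → ⊥-elim (<-irrefl refl (≤-trans m<2 2≤m)) })
                            (λ { (_ , 2≤m , m<1) → ⊥-elim (<-irrefl refl (≤-trans (≤-trans m<1 (s≤s z≤n)) 2≤m)) })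
  below (suc (suc n)) m = mk⇔ id id

-- Split partitions

module SplitPartitions {n} (M : Adj n) (isGraph : IsGraph M) where

  open Σ isGraph renaming (proj₁ to irreflexive; proj₂ to symmetric)

  IsSplit : (Fin n → Bool) → Set
  IsSplit = IsSplitPartition M

  CliqueMaximal : (Fin n → Bool) → Set
  CliqueMaximal side = ∀ y → side y ≡ false → ∃ λ z → side z ≡ true × adj M y z ≡ false

  Movable : (Fin n → Bool) → Fin n → Set
  Movable side v = side v ≡ true × (∀ y → side y ≡ false → adj M v y ≡ false)

  Swappable : (Fin n → Bool) → Fin n → Set
  Swappable side v = side v ≡ false × ∃ λ u → Movable side u × (∀ z → side z ≡ true → z ≢ u → adj M v z ≡ true)

  moveTo : (Fin n → Bool) → Fin n → Bool → Fin n → Bool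
  moveTo side u b = updateAt side u (const b)

  private
    moveTo-view : ∀ side u b i → (i ≡ u × moveTo side u b i ≡ b) ⊎ (i ≢ u × moveTo side u b i ≡ side i)
    moveTo-view side u b i with i ≟ u
    ... | yes refl = inj₁ (refl , updateAt-updates u side)
    ... | no i≢u = inj₂ (i≢u , updateAt-minimal i u side i≢u)

  addToClique : ∀ {side u} → IsSplit side → (∀ z → side z ≡ true → z ≢ u → adj M u z ≡ true) →
                IsSplit (moveTo side u true)
  addToClique {side} {u} (clique , independent) u-joins = clique′ , independent′
    where
    clique′ : ∀ i j → i ≢ j → moveTo side u true i ≡ true → moveTo side u true j ≡ true → adj M i j ≡ true
    clique′ i j i≢j si sj with moveTo-view side u true i | moveTo-view side u true j
    ... | inj₁ (refl , _)  | inj₁ (refl , _)  = ⊥-elim (i≢j refl)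
    ... | inj₁ (refl , _)  | inj₂ (j≢u , sj≡) = u-joins j (trans (sym sj≡) sj) j≢u
    ... | inj₂ (i≢u , si≡) | inj₁ (refl , _)  = trans (symmetric i u) (u-joins i (trans (sym si≡) si) i≢u)
    ... | inj₂ (_ , si≡)   | inj₂ (_ , sj≡)   = clique i j i≢j (trans (sym si≡) si) (trans (sym sj≡) sj)
    independent′ : ∀ i j → moveTo side u true i ≡ false → moveTo side u true j ≡ false → adj M i j ≡ false
    independent′ i j si sj with moveTo-view side u true i | moveTo-view side u true j
    ... | inj₁ (_ , si≡)   | _                = ⊥-elim (not-¬ si≡ si)
    ... | inj₂ _           | inj₁ (_ , sj≡)   = ⊥-elim (not-¬ sj≡ sj)
    ... | inj₂ (_ , si≡)   | inj₂ (_ , sj≡)   = independent i j (trans (sym si≡) si) (trans (sym sj≡) sj)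

  addToIndependent : ∀ {side u} → IsSplit side → (∀ y → side y ≡ false → adj M u y ≡ false) →
                     IsSplit (moveTo side u false)
  addToIndependent {side} {u} (clique , independent) u-isolated = clique′ , independent′
    where
    clique′ : ∀ i j → i ≢ j → moveTo side u false i ≡ true → moveTo side u false j ≡ true → adj M i j ≡ true
    clique′ i j i≢j si sj with moveTo-view side u false i | moveTo-view side u false j
    ... | inj₁ (_ , si≡)   | _                = ⊥-elim (not-¬ si si≡)
    ... | inj₂ _           | inj₁ (_ , sj≡)   = ⊥-elim (not-¬ sj sj≡)
    ... | inj₂ (_ , si≡)   | inj₂ (_ , sj≡)   = clique i j i≢j (trans (sym si≡) si) (trans (sym sj≡) sj)
    independent′ : ∀ i j → moveTo side u false i ≡ false → moveTo side u false j ≡ false → adj M i j ≡ false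
    independent′ i j si sj with moveTo-view side u false i | moveTo-view side u false j
    ... | inj₁ (refl , _)  | inj₁ (refl , _)  = irreflexive i
    ... | inj₁ (refl , _)  | inj₂ (_ , sj≡)   = u-isolated j (trans (sym sj≡) sj)
    ... | inj₂ (_ , si≡)   | inj₁ (refl , _)  = trans (symmetric i u) (u-isolated i (trans (sym si≡) si))
    ... | inj₂ (_ , si≡)   | inj₂ (_ , sj≡)   = independent i j (trans (sym si≡) si) (trans (sym sj≡) sj)

  -- One move suffices: after y joins the clique, y itself is a non-neighbour of every other independent vertex.
  maximise : ∀ {side₀} → IsSplit side₀ → ∃ λ side → IsSplit side × CliqueMaximal side
  maximise {side₀} split₀
    with any? (λ y → (side₀ y Bool.≟ false) ×-dec all? (λ z → (side₀ z Bool.≟ true) →-dec (adj M y z Bool.≟ true)))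
  ... | yes (y , y∈I , y-joins) = moveTo side₀ y true , addToClique split₀ (λ z z∈K _ → y-joins z z∈K) , maximal
    where
    maximal : CliqueMaximal (moveTo side₀ y true)
    maximal w sw with moveTo-view side₀ y true w
    ... | inj₁ (_ , sw≡) = ⊥-elim (not-¬ sw≡ sw)
    ... | inj₂ (_ , sw≡) = y , updateAt-updates y side₀ , proj₂ split₀ w y (trans (sym sw≡) sw) y∈I
  ... | no no-joiner = side₀ , split₀ , maximal
    where
    maximal : CliqueMaximal side₀
    maximal y y∈I =
      let (z , ¬joins) = ¬∀⟶∃¬ n _ (λ z → (side₀ z Bool.≟ true) →-dec (adj M y z Bool.≟ true))
                                   (λ joins → no-joiner (y , y∈I , joins))
      in z , ¬-not (λ z∈I → ¬joins λ z∈K → ⊥-elim (not-¬ z∈K z∈I)) , ¬-not (λ yz → ¬joins λ _ → yz)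

  module _ {side side′} (split : IsSplit side) (maximal : CliqueMaximal side) (split′ : IsSplit side′) where

    open Σ split renaming (proj₁ to clique; proj₂ to independent)
    open Σ split′ renaming (proj₁ to clique′; proj₂ to independent′)

    private
      different-sides : ∀ {a b} → side a ≡ true → side b ≡ false → a ≢ b
      different-sides sa sb refl = not-¬ sa sb

    leaver-isolated : ∀ {v y} → side v ≡ true → side′ v ≡ false → side y ≡ false → adj M v y ≡ false
    leaver-isolated {v} {y} v∈K v∈I′ y∈I = ¬-not λ vy → absurd vy (maximal y y∈I)
      where
      absurd : adj M v y ≡ true → (∃ λ z → side z ≡ true × adj M y z ≡ false) → ⊥
      absurd vy (z , z∈K , yz) with side′ y in y∈′ | side′ z in z∈′
      ... | false | _     = not-¬ vy (independent′ v y v∈I′ y∈′)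
      ... | true  | true  = not-¬ (clique′ y z (different-sides z∈K y∈I ∘ sym) y∈′ z∈′) yz
      ... | true  | false = not-¬ (clique v z v≢z v∈K z∈K) (independent′ v z v∈I′ z∈′)
        where
        v≢z : v ≢ z
        v≢z refl = not-¬ (trans (symmetric y v) vy) yz

    module _ {v} (v∈I : side v ≡ false) (v∈K′ : side′ v ≡ true) where

      missed-leaves : ∀ {z} → side z ≡ true → adj M v z ≡ false → side′ z ≡ false
      missed-leaves {z} z∈K vz = ¬-not λ z∈K′ → not-¬ (clique′ v z (different-sides z∈K v∈I ∘ sym) v∈K′ z∈K′) vz

      missed-unique : ∀ {z₁ z₂} → side z₁ ≡ true → adj M v z₁ ≡ false → side z₂ ≡ true → adj M v z₂ ≡ false → z₁ ≡ z₂
      missed-unique {z₁} {z₂} z₁∈K vz₁ z₂∈K vz₂ with z₁ ≟ z₂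
      ... | yes z₁≡z₂ = z₁≡z₂
      ... | no z₁≢z₂ = ⊥-elim (not-¬ (clique z₁ z₂ z₁≢z₂ z₁∈K z₂∈K)
                                     (independent′ z₁ z₂ (missed-leaves z₁∈K vz₁) (missed-leaves z₂∈K vz₂)))

      missed-isolated : ∀ {z y} → side z ≡ true → adj M v z ≡ false → side y ≡ false → adj M z y ≡ false
      missed-isolated {z} {y} z∈K vz y∈I = ¬-not λ zy → absurd zy
        where
        absurd : adj M z y ≡ true → ⊥
        absurd zy with side′ y in y∈′
        ... | false = not-¬ zy (independent′ z y (missed-leaves z∈K vz) y∈′)
        ... | true  = not-¬ (clique′ v y v≢y v∈K′ y∈′) (independent v y v∈I y∈I)
          where
          v≢y : v ≢ y
          v≢y refl = not-¬ zy (trans (symmetric z v) vz)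

  InQ⇒movable⊎swappable : ∀ {side} → IsSplit side → CliqueMaximal side → ∀ v → InQ M v →
                          Movable side v ⊎ Swappable side v
  InQ⇒movable⊎swappable {side} split maximal v ((_ , split₁ , v∈K₁) , (_ , split₂ , v∈I₂)) with side v in sv
  ... | true = inj₁ (refl , λ y y∈I → leaver-isolated split maximal split₂ sv v∈I₂ y∈I)
  ... | false with maximal v sv
  ...   | z , z∈K , vz = inj₂ (refl , z , (z∈K , λ y → missed-isolated split maximal split₁ sv v∈K₁ z∈K vz) ,
                               λ z′ z′∈K z′≢z → ¬-not λ vz′ → z′≢z (missed-unique split maximal split₁ sv v∈K₁ z′∈K vz′ z∈K vz))

  movable⇒InQ : ∀ {side v} → IsSplit side → Movable side v → InQ M v
  movable⇒InQ {side} {v} split (v∈K , v-isolated) =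
    (side , split , v∈K) , (moveTo side v false , addToIndependent split v-isolated , updateAt-updates v side)

  two-movable⇒¬swappable : ∀ {side a b w} → a ≢ b → Movable side a → Movable side b → ¬ Swappable side w
  two-movable⇒¬swappable {a = a} {b} {w} a≢b (a∈K , a-isolated) (b∈K , b-isolated) (w∈I , u , _ , w-joins) with a ≟ u
  ... | yes refl = not-¬ (w-joins b b∈K (a≢b ∘ sym)) (trans (symmetric w b) (b-isolated w w∈I))
  ... | no a≢u = not-¬ (w-joins a a∈K a≢u) (trans (symmetric w a) (a-isolated w w∈I))

-- Graphs of configurations


lookup-ext : ∀ {A : Set} {xs ys : Vec A n} → (∀ i → lookup xs i ≡ lookup ys i) → xs ≡ ys
lookup-ext {xs = xs} {ys} same = trans (sym (tabulate∘lookup xs)) (trans (tabulate-cong same) (tabulate∘lookup ys))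

adj-ext : {M N : Adj n} → (∀ i j → adj M i j ≡ adj N i j) → M ≡ N
adj-ext same = lookup-ext λ i → lookup-ext (same i)

offDiagonal : (Fin n → Fin n → Bool) → Adj n
offDiagonal f = tabulate λ i → tabulate λ j → if does (i ≟ j) then false else f i j

adj-tabulate : (f : Fin n → Fin n → Bool) → ∀ i j → adj (tabulate λ i → tabulate (f i)) i j ≡ f i j
adj-tabulate f i j = trans (cong (λ row → lookup row j) (lookup∘tabulate _ i)) (lookup∘tabulate _ j)

module _ {f : Fin n → Fin n → Bool} where

  private
    adj-offDiagonal : ∀ i j → adj (offDiagonal f) i j ≡ (if does (i ≟ j) then false else f i j)
    adj-offDiagonal = adj-tabulate _

  adj-offDiagonal-≢ : ∀ {i j} → i ≢ j → adj (offDiagonal f) i j ≡ f i j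
  adj-offDiagonal-≢ {i} {j} i≢j with i ≟ j | adj-offDiagonal i j
  ... | yes i≡j | _ = ⊥-elim (i≢j i≡j)
  ... | no _ | eq = eq

  adj-offDiagonal-≡ : ∀ i → adj (offDiagonal f) i i ≡ false
  adj-offDiagonal-≡ i with i ≟ i | adj-offDiagonal i i
  ... | yes _ | eq = eq
  ... | no i≢i | _ = ⊥-elim (i≢i refl)

  offDiagonal-isGraph : (∀ i j → i ≢ j → f i j ≡ f j i) → IsGraph (offDiagonal f)
  offDiagonal-isGraph f-sym = adj-offDiagonal-≡ , symmetric
    where
    symmetric : ∀ i j → adj (offDiagonal f) i j ≡ adj (offDiagonal f) j i
    symmetric i j with i ≟ j
    ... | yes refl = refl
    ... | no i≢j = trans (adj-offDiagonal-≢ i≢j) (trans (f-sym i j i≢j) (sym (adj-offDiagonal-≢ (i≢j ∘ sym))))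

complement : Adj n → Adj n
complement M = offDiagonal λ i j → not (adj M i j)

module _ (M : Adj n) (isGraph : IsGraph M) where

  complement-isGraph : IsGraph (complement M)
  complement-isGraph = offDiagonal-isGraph λ i j _ → cong not (proj₂ isGraph i j)

  complement-involutive : complement (complement M) ≡ M
  complement-involutive = adj-ext λ i j → case i ≟ j of λ
    { (yes refl) → trans (adj-offDiagonal-≡ i) (sym (proj₁ isGraph i))
    ; (no i≢j) → trans (adj-offDiagonal-≢ i≢j) (trans (cong not (adj-offDiagonal-≢ i≢j)) (not-involutive _)) }

  complement-split : ∀ {side} → IsSplitPartition M side → IsSplitPartition (complement M) (not ∘ side)
  complement-split {side} (clique , independent) = clique′ , independent′
    where
    clique′ : ∀ i j → i ≢ j → not (side i) ≡ true → not (side j) ≡ true → adj (complement M) i j ≡ true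
    clique′ i j i≢j si sj = trans (adj-offDiagonal-≢ i≢j) (cong not (independent i j (Bool.not-injective si) (Bool.not-injective sj)))
    independent′ : ∀ i j → not (side i) ≡ false → not (side j) ≡ false → adj (complement M) i j ≡ false
    independent′ i j si sj with i ≟ j
    ... | yes refl = adj-offDiagonal-≡ i
    ... | no i≢j = trans (adj-offDiagonal-≢ i≢j) (cong not (clique i j i≢j (Bool.not-injective si) (Bool.not-injective sj)))

  InQ-complement : ∀ {v} → InQ M v → InQ (complement M) v
  InQ-complement ((side₁ , split₁ , v∈K₁) , (side₂ , split₂ , v∈I₂)) =
    (not ∘ side₂ , complement-split split₂ , cong not v∈I₂) , (not ∘ side₁ , complement-split split₁ , cong not v∈K₁)

  complement-isSplitGraph : IsSplitGraph M → IsSplitGraph (complement M)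
  complement-isSplitGraph (_ , side , split) = complement-isGraph , not ∘ side , complement-split split

InQ-complement⁻ : (M : Adj n) → IsGraph M → ∀ {v} → InQ (complement M) v → InQ M v
InQ-complement⁻ M isGraph {v} v∈Q =
  subst (λ N → InQ N v) (complement-involutive M isGraph)
        (InQ-complement (complement M) (complement-isGraph M isGraph) v∈Q)

roleAdj : Role → Role → Bool → Bool → Bool
roleAdj K I e _  = e
roleAdj I K _ e′ = e′
roleAdj I _ _ _  = false
roleAdj _ I _ _  = false
roleAdj _ _ _ _  = true

roleAdj-sym : ∀ a b e e′ → roleAdj a b e e′ ≡ roleAdj b a e′ e
roleAdj-sym Q Q _ _ = refl
roleAdj-sym Q K _ _ = refl
roleAdj-sym Q I _ _ = refl
roleAdj-sym K Q _ _ = refl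
roleAdj-sym K K _ _ = refl
roleAdj-sym K I _ _ = refl
roleAdj-sym I Q _ _ = refl
roleAdj-sym I K _ _ = refl
roleAdj-sym I I _ _ = refl

graphOf : Vec Role n → Adj n → Adj n
graphOf r E = offDiagonal λ i j → roleAdj (lookup r i) (lookup r j) (adj E i j) (adj E j i)

graphOf-isGraph : (r : Vec Role n) (E : Adj n) → IsGraph (graphOf r E)
graphOf-isGraph r E = offDiagonal-isGraph λ i j _ → roleAdj-sym (lookup r i) (lookup r j) _ _

inClique : Role → Bool
inClique I = false
inClique _ = true

module _ {r : Vec Role n} {E : Adj n} (valid : ValidEdges r E) where

  edge⇒K-I : ∀ {i j} → adj E i j ≡ true → lookup r i ≡ K × lookup r j ≡ I
  edge⇒K-I {i} {j} Eij with lookup r i | Pointwise.lookup valid i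
  ... | Q | zeroRow = ⊥-elim (not-¬ Eij (trans (cong (λ row → lookup row j) zeroRow) (lookup-replicate j false)))
  ... | I | zeroRow = ⊥-elim (not-¬ Eij (trans (cong (λ row → lookup row j) zeroRow) (lookup-replicate j false)))
  ... | K | (supported , _) with lookup r j | Pointwise.lookup supported j
  ...   | Q | Eij≡false = ⊥-elim (not-¬ Eij Eij≡false)
  ...   | K | Eij≡false = ⊥-elim (not-¬ Eij Eij≡false)
  ...   | I | _ = refl , refl

  K⇒edge : ∀ {i} → lookup r i ≡ K → ∃ λ j → adj E i j ≡ true
  K⇒edge {i} ri with lookup r i | Pointwise.lookup valid i
  K⇒edge {i} refl | K | (_ , nonzero) =
    Product.map₂ ¬-not (¬∀⟶∃¬ _ _ (λ j → adj E i j Bool.≟ false)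
                          (λ allFalse → nonzero (lookup-ext λ j → trans (allFalse j) (sym (lookup-replicate j false)))))

  non-K-I⇒no-edge : ∀ {i j} → ¬ (lookup r i ≡ K × lookup r j ≡ I) → adj E i j ≡ false
  non-K-I⇒no-edge ¬K-I = ¬-not (¬K-I ∘ edge⇒K-I)

inClique≡false⇒I : ∀ {a} → inClique a ≡ false → a ≡ I
inClique≡false⇒I {I} _ = refl

roleAdj-inClique : ∀ {a b} e e′ → inClique a ≡ true → inClique b ≡ true → roleAdj a b e e′ ≡ true
roleAdj-inClique {Q} {Q} _ _ _ _ = refl
roleAdj-inClique {Q} {K} _ _ _ _ = refl
roleAdj-inClique {K} {Q} _ _ _ _ = refl
roleAdj-inClique {K} {K} _ _ _ _ = refl

adj-graphOf : (r : Vec Role n) (E : Adj n) → ∀ {i j} → i ≢ j →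
              adj (graphOf r E) i j ≡ roleAdj (lookup r i) (lookup r j) (adj E i j) (adj E j i)
adj-graphOf r E = adj-offDiagonal-≢

adj-graphOf-roles : (r : Vec Role n) (E : Adj n) → ∀ {i j a b} → lookup r i ≡ a → lookup r j ≡ b → a ≢ b →
                    adj (graphOf r E) i j ≡ roleAdj a b (adj E i j) (adj E j i)
adj-graphOf-roles r E {i} {j} refl refl a≢b =
  adj-graphOf r E λ { refl → a≢b refl }

module ConfigGraph {r : Vec Role n} {E : Adj n} (valid : ValidEdges r E) (twoQ : 2 ≤ count Q r) where

  G : Adj n
  G = graphOf r E

  open SplitPartitions G (graphOf-isGraph r E)

  private
    pair : ∃ λ w₁ → ∃ λ w₂ → w₁ ≢ w₂ × lookup r w₁ ≡ Q × lookup r w₂ ≡ Q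
    pair = Count-two (Count-positions Q r) twoQ

  w₁ w₂ : Fin n
  w₁ = proj₁ pair
  w₂ = proj₁ (proj₂ pair)
  w₁≢w₂ : w₁ ≢ w₂
  w₁≢w₂ = proj₁ (proj₂ (proj₂ pair))
  rw₁ : lookup r w₁ ≡ Q
  rw₁ = proj₁ (proj₂ (proj₂ (proj₂ pair)))
  rw₂ : lookup r w₂ ≡ Q
  rw₂ = proj₂ (proj₂ (proj₂ (proj₂ pair)))

  I-Q-nonadjacent : ∀ {y w} → lookup r y ≡ I → lookup r w ≡ Q → adj G y w ≡ false
  I-Q-nonadjacent ry rw = adj-graphOf-roles r E ry rw λ ()

  side₀ : Fin n → Bool
  side₀ v = inClique (lookup r v)

  split₀ : IsSplit side₀
  split₀ = clique , independent
    where
    clique : ∀ i j → i ≢ j → side₀ i ≡ true → side₀ j ≡ true → adj G i j ≡ true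
    clique i j i≢j si sj = trans (adj-graphOf r E i≢j) (roleAdj-inClique _ _ si sj)
    independent : ∀ i j → side₀ i ≡ false → side₀ j ≡ false → adj G i j ≡ false
    independent i j si sj with i ≟ j
    ... | yes refl = proj₁ (graphOf-isGraph r E) i
    ... | no i≢j = trans (adj-graphOf r E i≢j)
                         (cong₂ (λ a b → roleAdj a b (adj E i j) (adj E j i)) (inClique≡false⇒I si) (inClique≡false⇒I sj))

  maximal₀ : CliqueMaximal side₀
  maximal₀ y y∈I = w₁ , cong inClique rw₁ , I-Q-nonadjacent (inClique≡false⇒I y∈I) rw₁

  Q⇒InQ : ∀ {v} → lookup r v ≡ Q → InQ G v
  Q⇒InQ {v} rv = movable⇒InQ split₀ (cong inClique rv , λ y y∈I →
    trans (proj₂ (graphOf-isGraph r E) v y) (I-Q-nonadjacent (inClique≡false⇒I y∈I) rv))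

  InQ⇒Q : ∀ {v} → InQ G v → lookup r v ≡ Q
  InQ⇒Q {v} v∈Q with InQ⇒movable⊎swappable split₀ maximal₀ v v∈Q
  ... | inj₁ (v∈K , v-isolated) = movable-role (lookup r v) refl v∈K
    where
    movable-role : ∀ a → lookup r v ≡ a → inClique a ≡ true → lookup r v ≡ Q
    movable-role Q rv _ = rv
    movable-role K rv _ with K⇒edge valid rv
    ... | j , Evj = ⊥-elim (not-¬ (trans (adj-graphOf-roles r E rv rj λ ()) Evj) (v-isolated j (cong inClique rj)))
      where
      rj : lookup r j ≡ I
      rj = proj₂ (edge⇒K-I valid Evj)
  ... | inj₂ (v∈I , u , _ , v-joins) with w₁ ≟ u
  ...   | yes refl = ⊥-elim (not-¬ (v-joins w₂ (cong inClique rw₂) (w₁≢w₂ ∘ sym)) (I-Q-nonadjacent (inClique≡false⇒I v∈I) rw₂))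
  ...   | no w₁≢u = ⊥-elim (not-¬ (v-joins w₁ (cong inClique rw₁) w₁≢u) (I-Q-nonadjacent (inClique≡false⇒I v∈I) rw₁))

  isSplitGraph : IsSplitGraph G
  isSplitGraph = graphOf-isGraph r E , side₀ , split₀

  Count-InQ : Count (InQ G) (count Q r)
  Count-InQ = Count-cong (λ v → mk⇔ Q⇒InQ InQ⇒Q) (Count-positions Q r)

roleAdj-Q-injective : ∀ {a b} e₁ e₂ e₃ e₄ → a ≢ Q → b ≢ Q → roleAdj a Q e₁ e₂ ≡ roleAdj b Q e₃ e₄ → a ≡ b
roleAdj-Q-injective {Q} _ _ _ _ a≢Q _ _ = ⊥-elim (a≢Q refl)
roleAdj-Q-injective {_} {Q} _ _ _ _ _ b≢Q _ = ⊥-elim (b≢Q refl)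
roleAdj-Q-injective {K} {K} _ _ _ _ _ _ _ = refl
roleAdj-Q-injective {I} {I} _ _ _ _ _ _ _ = refl
roleAdj-Q-injective {K} {I} _ _ _ _ _ _ ()
roleAdj-Q-injective {I} {K} _ _ _ _ _ _ ()

adj-graphOf-K-I : (r : Vec Role n) (E : Adj n) → ∀ {i j} → lookup r i ≡ K → lookup r j ≡ I → adj (graphOf r E) i j ≡ adj E i j
adj-graphOf-K-I r E ri rj = adj-graphOf-roles r E ri rj λ ()

module _ {r r′ : Vec Role n} {E E′ : Adj n}
         (valid : ValidEdges r E) (twoQ : 2 ≤ count Q r) (valid′ : ValidEdges r′ E′) (twoQ′ : 2 ≤ count Q r′) where

  private
    module C = ConfigGraph valid twoQ
    module C′ = ConfigGraph valid′ twoQ′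

  graphOf-injective : graphOf r E ≡ graphOf r′ E′ → r ≡ r′ × E ≡ E′
  graphOf-injective G≡G′ = r≡r′ , adj-ext same-edge
    where
    Q⇒Q′ : ∀ {v} → lookup r v ≡ Q → lookup r′ v ≡ Q
    Q⇒Q′ {v} rv = C′.InQ⇒Q (subst (λ G → InQ G v) G≡G′ (C.Q⇒InQ rv))
    Q′⇒Q : ∀ {v} → lookup r′ v ≡ Q → lookup r v ≡ Q
    Q′⇒Q {v} r′v = C.InQ⇒Q (subst (λ G → InQ G v) (sym G≡G′) (C′.Q⇒InQ r′v))
    same-role : ∀ v → lookup r v ≡ lookup r′ v
    same-role v with lookup r v ≟ᴿ Q
    ... | yes rv = trans rv (sym (Q⇒Q′ rv))
    ... | no rv≢Q = roleAdj-Q-injective _ _ _ _ rv≢Q (rv≢Q ∘ Q′⇒Q) (begin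
      roleAdj (lookup r v) Q (adj E v C.w₁) (adj E C.w₁ v)      ≡⟨ sym (adj-graphOf-roles r E refl C.rw₁ rv≢Q) ⟩
      adj (graphOf r E) v C.w₁                                ≡⟨ cong (λ G → adj G v C.w₁) G≡G′ ⟩
      adj (graphOf r′ E′) v C.w₁                              ≡⟨ adj-graphOf-roles r′ E′ refl (Q⇒Q′ C.rw₁) (rv≢Q ∘ Q′⇒Q) ⟩
      roleAdj (lookup r′ v) Q (adj E′ v C.w₁) (adj E′ C.w₁ v)  ∎)
      where open ≡-Reasoning
    r≡r′ : r ≡ r′
    r≡r′ = lookup-ext same-role
    same-edge : ∀ i j → adj E i j ≡ adj E′ i j
    same-edge i j with lookup r i ≟ᴿ K | lookup r j ≟ᴿ I
    ... | yes ri | yes rj =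
      trans (sym (adj-graphOf-K-I r E ri rj))
            (trans (cong (λ G → adj G i j) G≡G′)
                   (adj-graphOf-K-I r′ E′ (trans (sym (same-role i)) ri) (trans (sym (same-role j)) rj)))
    ... | no ri≢K | _ =
      trans (non-K-I⇒no-edge valid (ri≢K ∘ proj₁)) (sym (non-K-I⇒no-edge valid′ (ri≢K ∘ trans (same-role i) ∘ proj₁)))
    ... | yes _ | no rj≢I =
      trans (non-K-I⇒no-edge valid (rj≢I ∘ proj₂)) (sym (non-K-I⇒no-edge valid′ (rj≢I ∘ trans (same-role j) ∘ proj₂)))

  complement-graphOf-injective : complement (graphOf r E) ≡ complement (graphOf r′ E′) → r ≡ r′ × E ≡ E′
  complement-graphOf-injective Gᶜ≡G′ᶜ = graphOf-injective (begin
    graphOf r E                            ≡⟨ sym (complement-involutive (graphOf r E) (graphOf-isGraph r E)) ⟩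
    complement (complement (graphOf r E))  ≡⟨ cong complement Gᶜ≡G′ᶜ ⟩
    complement (complement (graphOf r′ E′)) ≡⟨ complement-involutive (graphOf r′ E′) (graphOf-isGraph r′ E′) ⟩
    graphOf r′ E′                          ∎)
    where open ≡-Reasoning

  graphOf≢complement : graphOf r E ≢ complement (graphOf r′ E′)
  graphOf≢complement G≡G′ᶜ = not-¬ (clique C.w₁≢w₂ C.rw₁ C.rw₂)
    (trans (cong (λ G → adj G C.w₁ C.w₂) G≡G′ᶜ)
           (trans (adj-offDiagonal-≢ C.w₁≢w₂) (cong not (clique′ C.w₁≢w₂ (Q⇒Q′ C.rw₁) (Q⇒Q′ C.rw₂)))))
    where
    clique : ∀ {i j} → i ≢ j → lookup r i ≡ Q → lookup r j ≡ Q → adj (graphOf r E) i j ≡ true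
    clique i≢j ri rj = proj₁ C.split₀ _ _ i≢j (cong inClique ri) (cong inClique rj)
    clique′ : ∀ {i j} → i ≢ j → lookup r′ i ≡ Q → lookup r′ j ≡ Q → adj (graphOf r′ E′) i j ≡ true
    clique′ i≢j ri rj = proj₁ C′.split₀ _ _ i≢j (cong inClique ri) (cong inClique rj)
    Q⇒Q′ : ∀ {v} → lookup r v ≡ Q → lookup r′ v ≡ Q
    Q⇒Q′ {v} rv = C′.InQ⇒Q (InQ-complement⁻ (graphOf r′ E′) (graphOf-isGraph r′ E′)
                                             (subst (λ G → InQ G v) G≡G′ᶜ (C.Q⇒InQ rv)))

-- Split graphs with two questioning vertices

edgeBit : Role → Role → Bool → Bool
edgeBit K I b = b
edgeBit _ _ _ = false

QIndependent : Adj n → Set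
QIndependent M = ∀ a b → InQ M a → InQ M b → a ≢ b → adj M a b ≡ false

module Roles (M : Adj n) (isGraph : IsGraph M) {side : Fin n → Bool}
             (split : IsSplitPartition M side) (maximal : SplitPartitions.CliqueMaximal M isGraph side) where

  open SplitPartitions M isGraph

  movable? : ∀ v → Dec (Movable side v)
  movable? v = (side v Bool.≟ true) ×-dec all? λ y → (side y Bool.≟ false) →-dec (adj M v y Bool.≟ false)

  private
    roleFrom : ∀ {v} → Dec (Movable side v) → Bool → Role
    roleFrom (yes _) _     = Q
    roleFrom (no _)  true  = K
    roleFrom (no _)  false = I

  roleOf : Fin n → Role
  roleOf v = roleFrom (movable? v) (side v)

  data RoleView (v : Fin n) : Role → Set where
    asQ : Movable side v → RoleView v Q
    asK : ¬ Movable side v → side v ≡ true → RoleView v K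
    asI : side v ≡ false → RoleView v I

  roleView : ∀ v → RoleView v (roleOf v)
  roleView v = view (movable? v) (side v) refl
    where
    view : (m? : Dec (Movable side v)) (b : Bool) → side v ≡ b → RoleView v (roleFrom m? b)
    view (yes m) _     _  = asQ m
    view (no ¬m) true  sv = asK ¬m sv
    view (no ¬m) false sv = asI sv

  roleOf-I : ∀ {v} → side v ≡ false → roleOf v ≡ I
  roleOf-I {v} sv with roleOf v | roleView v
  ... | Q | asQ (sv′ , _) = ⊥-elim (not-¬ sv′ sv)
  ... | K | asK _ sv′      = ⊥-elim (not-¬ sv′ sv)
  ... | I | asI _     = refl

  r : Vec Role n
  r = tabulate roleOf

  E : Adj n
  E = tabulate λ i → tabulate λ j → edgeBit (roleOf i) (roleOf j) (adj M i j)

  open Σ split renaming (proj₁ to clique; proj₂ to independent)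
  open Σ isGraph using () renaming (proj₂ to symmetric)

  adj-byRoles : ∀ i j → i ≢ j → adj M i j ≡ roleAdj (roleOf i) (roleOf j) (edgeBit (roleOf i) (roleOf j) (adj M i j))
                                                                          (edgeBit (roleOf j) (roleOf i) (adj M j i))
  adj-byRoles i j i≢j with roleOf i | roleView i | roleOf j | roleView j
  ... | Q | asQ mi      | Q | asQ mj      = clique i j i≢j (proj₁ mi) (proj₁ mj)
  ... | Q | asQ mi      | K | asK _ sj     = clique i j i≢j (proj₁ mi) sj
  ... | Q | asQ mi      | I | asI sj = proj₂ mi j sj
  ... | K | asK _ si     | Q | asQ mj      = clique i j i≢j si (proj₁ mj)
  ... | K | asK _ si     | K | asK _ sj     = clique i j i≢j si sj
  ... | K | _               | I | _               = refl
  ... | I | _               | K | _               = symmetric i j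
  ... | I | asI si  | Q | asQ mj      = trans (symmetric i j) (proj₂ mj i si)
  ... | I | asI si  | I | asI sj = independent i j si sj

  M≡graphOf : M ≡ graphOf r E
  M≡graphOf = adj-ext same
    where
    lookup-r : ∀ i → lookup r i ≡ roleOf i
    lookup-r = lookup∘tabulate roleOf
    adj-E : ∀ i j → adj E i j ≡ edgeBit (roleOf i) (roleOf j) (adj M i j)
    adj-E = adj-tabulate λ i j → edgeBit (roleOf i) (roleOf j) (adj M i j)
    same : ∀ i j → adj M i j ≡ adj (graphOf r E) i j
    same i j with i ≟ j
    ... | yes refl = trans (proj₁ isGraph i) (sym (proj₁ (graphOf-isGraph r E) i))
    ... | no i≢j = trans (adj-byRoles i j i≢j) (sym (trans (adj-graphOf r E i≢j)
                     (cong₂ (λ (a , b) (e , e′) → roleAdj a b e e′)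
                            (cong₂ _,_ (lookup-r i) (lookup-r j)) (cong₂ _,_ (adj-E i j) (adj-E j i)))))

  validEdges : ValidEdges r E
  validEdges = Pointwise.tabulate⁺ row
    where
    allFalse : ∀ {g : Fin n → Bool} → (∀ j → g j ≡ false) → tabulate g ≡ falses
    allFalse h = lookup-ext λ j → trans (lookup∘tabulate _ j) (trans (h j) (sym (lookup-replicate j false)))
    row : ∀ i → RowOf r (roleOf i) (tabulate λ j → edgeBit (roleOf i) (roleOf j) (adj M i j))
    row i with roleOf i | roleView i
    ... | Q | _ = allFalse λ _ → refl
    ... | I | _ = allFalse λ _ → refl
    ... | K | asK ¬m si = Pointwise.tabulate⁺ (λ j → allowed (roleOf j)) , nonzero neighbour
      where
      allowed : ∀ a {b} → Allowed a (edgeBit K a b)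
      allowed Q = refl
      allowed K = refl
      allowed I = tt
      neighbour : ∃ λ y → ¬ (side y ≡ false → adj M i y ≡ false)
      neighbour = ¬∀⟶∃¬ n _ (λ y → (side y Bool.≟ false) →-dec (adj M i y Bool.≟ false))
                              (λ isolated → ¬m (si , isolated))
      nonzero : (∃ λ y → ¬ (side y ≡ false → adj M i y ≡ false)) →
                tabulate (λ j → edgeBit K (roleOf j) (adj M i j)) ≢ falses
      nonzero (y , ¬isolated) row≡falses = not-¬ (trans (cong (λ a → edgeBit K a (adj M i y)) (roleOf-I y∈I)) iy)
        (trans (sym (lookup∘tabulate (λ j → edgeBit K (roleOf j) (adj M i j)) y))
               (trans (cong (λ row → lookup row y) row≡falses) (lookup-replicate y false)))
        where
        y∈I : side y ≡ false
        y∈I = ¬-not λ y∈K → ¬isolated λ y∈I → ⊥-elim (not-¬ y∈K y∈I)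
        iy : adj M i y ≡ true
        iy = ¬-not λ iy≡false → ¬isolated λ _ → iy≡false

  Q⇒InQ : ∀ {v} → lookup r v ≡ Q → InQ M v
  Q⇒InQ {v} rv with roleOf v | roleView v | trans (sym (lookup∘tabulate roleOf v)) rv
  ... | Q | asQ m | _ = movable⇒InQ split m

  movable⇒Q : ∀ {v} → Movable side v → lookup r v ≡ Q
  movable⇒Q {v} m = trans (lookup∘tabulate roleOf v) (byView (roleOf v) (roleView v))
    where
    byView : ∀ a → RoleView v a → a ≡ Q
    byView Q _ = refl
    byView K (asK ¬m _) = ⊥-elim (¬m m)
    byView I (asI sv) = ⊥-elim (not-¬ (proj₁ m) sv)

  -- Every questioning vertex is u or lies in I: a movable vertex x ≢ u would be adjacent to w ∈ I.
  swappable⇒QIndependent : ∀ {w} → Swappable side w → QIndependent M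
  swappable⇒QIndependent {w} (w∈I , u , (u∈K , u-isolated) , w-joins) a b a∈Q b∈Q a≢b =
    byPlace (place a a∈Q) (place b b∈Q)
    where
    place : ∀ x → InQ M x → x ≡ u ⊎ side x ≡ false
    place x x∈Q with InQ⇒movable⊎swappable split maximal x x∈Q
    ... | inj₂ (x∈I , _) = inj₂ x∈I
    ... | inj₁ (x∈K , x-isolated) with x ≟ u
    ...   | yes x≡u = inj₁ x≡u
    ...   | no x≢u = ⊥-elim (not-¬ (w-joins x x∈K x≢u) (trans (symmetric w x) (x-isolated w w∈I)))
    byPlace : a ≡ u ⊎ side a ≡ false → b ≡ u ⊎ side b ≡ false → adj M a b ≡ false
    byPlace (inj₁ refl) (inj₁ refl) = ⊥-elim (a≢b refl)
    byPlace (inj₁ refl) (inj₂ b∈I)  = u-isolated b b∈I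
    byPlace (inj₂ a∈I)  (inj₁ refl) = trans (symmetric a b) (u-isolated a a∈I)
    byPlace (inj₂ a∈I)  (inj₂ b∈I)  = independent a b a∈I b∈I

CliqueRepresentation : Adj n → Set
CliqueRepresentation {n} M =
  ∃ λ ((r , E) : Config n) → ValidEdges r E × M ≡ graphOf r E × (∀ v → InQ M v ⇔ lookup r v ≡ Q)

represented⊎QIndependent : (M : Adj n) → IsSplitGraph M → ∀ {a b} → a ≢ b → InQ M a → InQ M b →
                           CliqueRepresentation M ⊎ QIndependent M
represented⊎QIndependent M (isGraph , _ , split₀) {a} {b} a≢b a∈Q b∈Q
  with SplitPartitions.maximise M isGraph split₀
... | side , split , maximal
  with SplitPartitions.InQ⇒movable⊎swappable M isGraph split maximal a a∈Q
     | SplitPartitions.InQ⇒movable⊎swappable M isGraph split maximal b b∈Q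
...   | inj₂ swappable | _              = inj₂ (Roles.swappable⇒QIndependent M isGraph split maximal swappable)
...   | inj₁ _         | inj₂ swappable = inj₂ (Roles.swappable⇒QIndependent M isGraph split maximal swappable)
...   | inj₁ a-movable | inj₁ b-movable =
  inj₁ ((r , E) , validEdges , M≡graphOf , λ v → mk⇔ InQ⇒Q Q⇒InQ)
  where
  open Roles M isGraph split maximal
  open SplitPartitions M isGraph using (InQ⇒movable⊎swappable; two-movable⇒¬swappable)
  InQ⇒Q : ∀ {v} → InQ M v → lookup r v ≡ Q
  InQ⇒Q {v} v∈Q with InQ⇒movable⊎swappable split maximal v v∈Q
  ... | inj₁ v-movable = movable⇒Q v-movable
  ... | inj₂ v-swappable = ⊥-elim (two-movable⇒¬swappable a≢b a-movable b-movable v-swappable)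

-- The exact count

TargetConfig : Config n → Set
TargetConfig {n} (r , E) = ValidEdges r E × 2 ≤ count Q r × count Q r < n

config⇒target : ∀ {x : Config n} → TargetConfig x → Target n (uncurry graphOf x)
config⇒target (valid , twoQ , <n) = isSplitGraph , _ , Count-InQ , twoQ , <n
  where open ConfigGraph valid twoQ

configᶜ⇒target : ∀ {x : Config n} → TargetConfig x → Target n (complement (uncurry graphOf x))
configᶜ⇒target {x = r , E} (valid , twoQ , <n) =
  complement-isSplitGraph (graphOf r E) (graphOf-isGraph r E) isSplitGraph , _ ,
  Count-cong (λ v → mk⇔ (InQ-complement (graphOf r E) (graphOf-isGraph r E))
                        (InQ-complement⁻ (graphOf r E) (graphOf-isGraph r E))) Count-InQ ,
  twoQ , <n
  where open ConfigGraph valid twoQ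

represented⇒targetConfig : (M : Adj n) → ∀ {r E k} → ValidEdges r E → (∀ v → InQ M v ⇔ lookup r v ≡ Q) →
                           Count (InQ M) k → 2 ≤ k → k < n → TargetConfig (r , E)
represented⇒targetConfig M {r} valid Q⇔ count-Q 2≤k k<n = valid , subst (2 ≤_) (sym k≡) 2≤k , subst (_< _) (sym k≡) k<n
  where
  k≡ : count Q r ≡ _
  k≡ = Count-unique (Count-cong (λ v → ⇔.sym (Q⇔ v)) (Count-positions Q r)) count-Q

QIndependent-complement : (M : Adj n) → IsGraph M → ∀ {a b} → a ≢ b → InQ M a → InQ M b →
                          QIndependent M → ¬ QIndependent (complement M)
QIndependent-complement M isGraph a≢b a∈Q b∈Q Q-independent Q-independentᶜ =
  not-¬ (trans (adj-offDiagonal-≢ a≢b) (cong not (Q-independent _ _ a∈Q b∈Q a≢b)))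
        (Q-independentᶜ _ _ (InQ-complement M isGraph a∈Q) (InQ-complement M isGraph b∈Q) a≢b)

target⇒config : ∀ {M : Adj n} → Target n M →
  (∃ λ x → TargetConfig x × M ≡ uncurry graphOf x) ⊎ (∃ λ x → TargetConfig x × M ≡ complement (uncurry graphOf x))
target⇒config {M = M} (splitGraph@(isGraph , _) , k , count-Q , 2≤k , k<n) with Count-two count-Q 2≤k
... | a , b , a≢b , a∈Q , b∈Q with represented⊎QIndependent M splitGraph a≢b a∈Q b∈Q
...   | inj₁ ((r , E) , valid , M≡ , Q⇔) = inj₁ ((r , E) , represented⇒targetConfig M valid Q⇔ count-Q 2≤k k<n , M≡)
...   | inj₂ Q-independent with represented⊎QIndependent (complement M) (complement-isSplitGraph M isGraph splitGraph) a≢b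
                                          (InQ-complement M isGraph a∈Q) (InQ-complement M isGraph b∈Q)
...     | inj₂ Q-independentᶜ = ⊥-elim (QIndependent-complement M isGraph a≢b a∈Q b∈Q Q-independent Q-independentᶜ)
...     | inj₁ ((r , E) , valid , Mᶜ≡ , Q⇔) =
  inj₂ ((r , E) , represented⇒targetConfig M valid Q⇔′ count-Q 2≤k k<n ,
        trans (sym (complement-involutive M isGraph)) (cong complement Mᶜ≡))
  where
  Q⇔′ : ∀ v → InQ M v ⇔ lookup r v ≡ Q
  Q⇔′ v = ⇔.trans (mk⇔ (InQ-complement M isGraph) (InQ-complement⁻ M isGraph)) (Q⇔ v)

Count-target : ∀ n → Count (Target n) (approx n n)
Count-target n =
  subst (Count (Target n)) S+S≡approx
    (Count-cong (λ M → mk⇔ [ (λ { (_ , t , refl) → config⇒target t }) , (λ { (_ , t , refl) → configᶜ⇒target t }) ]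
                           target⇒config)
      (Count-⊎ disjoint (Count-image (uncurry graphOf) injective (Count-targetConfigs n))
                        (Count-image (complement ∘ uncurry graphOf) injectiveᶜ (Count-targetConfigs n))))
  where
  S : ℕ
  S = sumFromTo 2 (n ∸ 1) λ q → sumFromTo 0 (n ∸ q) (summand n q)
  S+S≡approx : S + S ≡ approx n n
  S+S≡approx = trans (cong (S +_) (sym (+-identityʳ S)))
                     (cong (λ m → 2 * sumFromTo 2 m λ q → sumFromTo 0 (n ∸ q) (summand n q)) (sym (m≥n⇒m⊓n≡n (m∸n≤m n 1))))
  injective : ∀ {x y : Config n} → TargetConfig x → TargetConfig y → uncurry graphOf x ≡ uncurry graphOf y → x ≡ y
  injective (valid , twoQ , _) (valid′ , twoQ′ , _) = uncurry (cong₂ _,_) ∘ graphOf-injective valid twoQ valid′ twoQ′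
  injectiveᶜ : ∀ {x y : Config n} → TargetConfig x → TargetConfig y →
               complement (uncurry graphOf x) ≡ complement (uncurry graphOf y) → x ≡ y
  injectiveᶜ (valid , twoQ , _) (valid′ , twoQ′ , _) = uncurry (cong₂ _,_) ∘ complement-graphOf-injective valid twoQ valid′ twoQ′
  disjoint : ∀ M → (∃ λ x → TargetConfig x × M ≡ uncurry graphOf x) →
                   (∃ λ y → TargetConfig y × M ≡ complement (uncurry graphOf y)) → ⊥
  disjoint M (_ , (valid , twoQ , _) , refl) (_ , (valid′ , twoQ′ , _) , eq) = graphOf≢complement valid twoQ valid′ twoQ′ eq

-- Growth estimates

open ≤-Reasoning

antitone : (f : ℕ → ℕ) → (∀ q → f (suc q) ≤ f q) → ∀ {a b} → a ≤ b → f b ≤ f a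
antitone f step {a} a≤b = subst (λ b → f b ≤ f a) (m+[n∸m]≡n a≤b) (go (_ ∸ a))
  where
  go : ∀ j → f (a + j) ≤ f a
  go zero = ≤-reflexive (cong f (+-identityʳ a))
  go (suc j) = ≤-trans (subst (λ m → f m ≤ f (a + j)) (sym (+-suc a j)) (step (a + j))) (go j)

C≤2^ : ∀ m k → m C k ≤ 2 ^ m
C≤2^ zero zero = ≤-refl
C≤2^ zero (suc k) = z≤n
C≤2^ (suc m) zero = m^n>0 2 (suc m)
C≤2^ (suc m) (suc k) = begin
  suc m C suc k      ≡⟨ pascal m k ⟩
  m C k + m C suc k  ≤⟨ +-mono-≤ (C≤2^ m k) (C≤2^ m (suc k)) ⟩
  2 ^ m + 2 ^ m      ≡⟨ cong (2 ^ m +_) (sym (+-identityʳ (2 ^ m))) ⟩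
  2 ^ suc m          ∎

C>0 : ∀ {m k} → k ≤ m → 1 ≤ m C k
C>0 {m} {zero} _ = ≤-refl
C>0 {suc m} {suc k} (s≤s k≤m) = subst (1 ≤_) (sym (pascal m k)) (≤-trans (C>0 k≤m) (m≤m+n _ _))

C-monoˡ : ∀ {m m′} k → m ≤ m′ → m C k ≤ m′ C k
C-monoˡ {m} k m≤m′ = subst (λ m′ → m C k ≤ m′ C k) (m+[n∸m]≡n m≤m′) (go (_ ∸ m))
  where
  step : ∀ m k → m C k ≤ suc m C k
  step m zero = ≤-refl
  step m (suc k) = subst (m C suc k ≤_) (sym (pascal m k)) (m≤n+m _ _)
  go : ∀ j → m C k ≤ (m + j) C k
  go zero = ≤-reflexive (cong (_C k) (sym (+-identityʳ m)))
  go (suc j) = ≤-trans (go j) (subst (λ m′ → (m + j) C k ≤ m′ C k) (sym (+-suc m j)) (step (m + j) k))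

C-suc≤ : ∀ n q → n C suc q ≤ n * (n C q)
C-suc≤ zero q = z≤n
C-suc≤ (suc m) q = begin
  suc m C suc q         ≡⟨ pascal m q ⟩
  m C q + m C suc q     ≤⟨ +-monoʳ-≤ (m C q) (C-suc≤ m q) ⟩
  m C q + m * (m C q)   ≡⟨⟩
  suc m * (m C q)       ≤⟨ *-monoʳ-≤ (suc m) (C-monoˡ q (n≤1+n m)) ⟩
  suc m * (suc m C q)   ∎

*-^-distrib : ∀ a b c → (a * b) ^ c ≡ a ^ c * b ^ c
*-^-distrib a b zero = refl
*-^-distrib a b (suc c) = trans (cong (a * b *_) (*-^-distrib a b c)) (*-interchange a b (a ^ c) (b ^ c))

private
  [2^[x∸1]∸1]*2≤2^x∸1 : ∀ x → (2 ^ (x ∸ 1) ∸ 1) * 2 ≤ 2 ^ x ∸ 1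
  [2^[x∸1]∸1]*2≤2^x∸1 zero = z≤n
  [2^[x∸1]∸1]*2≤2^x∸1 (suc y) = begin
    (2 ^ y ∸ 1) * 2  ≡⟨ *-distribʳ-∸ 2 (2 ^ y) 1 ⟩
    2 ^ y * 2 ∸ 2    ≤⟨ ∸-monoʳ-≤ (2 ^ y * 2) (s≤s z≤n) ⟩
    2 ^ y * 2 ∸ 1    ≡⟨ cong (_∸ 1) (*-comm (2 ^ y) 2) ⟩
    2 ^ suc y ∸ 1    ∎

summand-ratio : ∀ n q c → summand n (suc q) c * 2 ^ c ≤ n * summand n q c
summand-ratio n q c = begin
  (n C suc q) * ((n ∸ suc q) C c) * Y′ * 2 ^ c     ≡⟨ *-assoc ((n C suc q) * ((n ∸ suc q) C c)) Y′ (2 ^ c) ⟩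
  (n C suc q) * ((n ∸ suc q) C c) * (Y′ * 2 ^ c)   ≤⟨ *-mono-≤ (*-mono-≤ (C-suc≤ n q) (C-monoˡ c (∸-monoʳ-≤ n (n≤1+n q)))) Y′2^c≤Y ⟩
  n * (n C q) * ((n ∸ q) C c) * Y                  ≡⟨ reassociate n (n C q) ((n ∸ q) C c) Y ⟩
  n * ((n C q) * ((n ∸ q) C c) * Y)                ∎
  where
  reassociate : ∀ n a b p → n * a * b * p ≡ n * (a * b * p)
  reassociate = solve-∀
  x Y Y′ : ℕ
  x = n ∸ c ∸ q
  Y = (2 ^ x ∸ 1) ^ c
  Y′ = (2 ^ (n ∸ c ∸ suc q) ∸ 1) ^ c
  Y′2^c≤Y : Y′ * 2 ^ c ≤ Y
  Y′2^c≤Y = begin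
    Y′ * 2 ^ c                      ≡⟨ cong (λ m → (2 ^ m ∸ 1) ^ c * 2 ^ c) (∸-suc (n ∸ c) q) ⟩
    (2 ^ (x ∸ 1) ∸ 1) ^ c * 2 ^ c   ≡⟨ sym (*-^-distrib (2 ^ (x ∸ 1) ∸ 1) 2 c) ⟩
    ((2 ^ (x ∸ 1) ∸ 1) * 2) ^ c     ≤⟨ ^-monoˡ-≤ c ([2^[x∸1]∸1]*2≤2^x∸1 x) ⟩
    Y                               ∎
    where
    ∸-suc : ∀ m q → m ∸ suc q ≡ m ∸ q ∸ 1
    ∸-suc m q = trans (cong (m ∸_) (+-comm 1 q)) (sym (∸-+-assoc m q 1))

summand-ratio-4d : ∀ n d q c → .{{NonZero n}} → 4 * d * n ≤ 2 ^ c → summand n (suc q) c * (4 * d) ≤ summand n q c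
summand-ratio-4d n d q c 4dn≤2^c = *-cancelʳ-≤ _ _ n (begin
  summand n (suc q) c * (4 * d) * n   ≡⟨ *-assoc (summand n (suc q) c) (4 * d) n ⟩
  summand n (suc q) c * (4 * d * n)   ≤⟨ *-monoʳ-≤ (summand n (suc q) c) 4dn≤2^c ⟩
  summand n (suc q) c * 2 ^ c         ≤⟨ summand-ratio n q c ⟩
  n * summand n q c                   ≡⟨ *-comm n _ ⟩
  summand n q c * n                   ∎)

summand-vanishes : ∀ n q c → n ∸ q < c → summand n q c ≡ 0
summand-vanishes n q c n∸q<c = begin-equality
  (n C q) * ((n ∸ q) C c) * Y  ≡⟨ cong (λ m → (n C q) * m * Y) (k>n⇒nCk≡0 n∸q<c) ⟩
  (n C q) * 0 * Y              ≡⟨ cong (_* Y) (*-zeroʳ (n C q)) ⟩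
  0                            ∎
  where
  Y : ℕ
  Y = (2 ^ (n ∸ c ∸ q) ∸ 1) ^ c

n<2^n : ∀ n → n < 2 ^ n
n<2^n zero = s≤s z≤n
n<2^n (suc n) = begin-strict
  suc n          <⟨ s≤s (n<2^n n) ⟩
  1 + 2 ^ n      ≤⟨ +-monoˡ-≤ (2 ^ n) (m^n>0 2 n) ⟩
  2 ^ n + 2 ^ n  ≡⟨ cong (2 ^ n +_) (sym (+-identityʳ (2 ^ n))) ⟩
  2 ^ suc n      ∎

64n²≤2^n : ∀ n → 20 ≤ n → 64 * (n * n) ≤ 2 ^ n
64n²≤2^n n 20≤n = subst Bound (m+[n∸m]≡n 20≤n) (from20 (n ∸ 20))
  where
  Bound : ℕ → Set
  Bound m = 64 * (m * m) ≤ 2 ^ m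
  square-step : ∀ t → suc (3 + t) * suc (3 + t) ≤ 2 * ((3 + t) * (3 + t))
  square-step t = ≤-trans (m≤m+n _ (t * t + 4 * t + 2)) (≤-reflexive (expand t))
    where
    expand : ∀ t → suc (3 + t) * suc (3 + t) + (t * t + 4 * t + 2) ≡ 2 * ((3 + t) * (3 + t))
    expand = solve-∀
  swap-factors : ∀ m → 64 * (2 * m) ≡ 2 * (64 * m)
  swap-factors = solve-∀
  step : ∀ m → 3 ≤ m → Bound m → Bound (suc m)
  step m 3≤m bound = begin
    64 * (suc m * suc m)   ≤⟨ *-monoʳ-≤ 64 (subst (λ m → suc m * suc m ≤ 2 * (m * m)) (m+[n∸m]≡n 3≤m) (square-step (m ∸ 3))) ⟩
    64 * (2 * (m * m))     ≡⟨ swap-factors (m * m) ⟩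
    2 * (64 * (m * m))     ≤⟨ *-monoʳ-≤ 2 bound ⟩
    2 * 2 ^ m              ∎
  from20 : ∀ j → Bound (20 + j)
  from20 zero = toWitness {a? = 64 * (20 * 20) ≤? 2 ^ 20} _
  from20 (suc j) = subst Bound (sym (+-suc 20 j)) (step (20 + j) (≤-trans (toWitness {a? = 3 ≤? 20} _) (m≤m+n 20 j)) (from20 j))

5+21n≤n² : ∀ n → 22 ≤ n → 5 + 21 * n ≤ n * n
5+21n≤n² n 22≤n = begin
  5 + 21 * n  ≤⟨ +-monoˡ-≤ (21 * n) (≤-trans (toWitness {a? = 5 ≤? 22} _) 22≤n) ⟩
  n + 21 * n  ≡⟨ solve List.[ n ] ⟩
  22 * n      ≤⟨ *-monoˡ-≤ n 22≤n ⟩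
  n * n       ∎

rowSum : ℕ → ℕ → ℕ
rowSum n q = sumFromTo 0 (n ∸ q) (summand n q)

-- k plays the role of n / 8: summands with c < k are crudely bounded, those with c ≥ k decay geometrically in q.
module Estimates (d n k : ℕ) (1≤d : 1 ≤ d) (22≤k : 22 ≤ k) (d≤k : d ≤ k) (8k≤n : 8 * k ≤ n) (n≤9k : n ≤ 9 * k) where

  private
    k≤n : k ≤ n
    k≤n = ≤-trans (m≤n*m k 8) 8k≤n
    3≤k : 3 ≤ k
    3≤k = ≤-trans (toWitness {a? = 3 ≤? 22} _) 22≤k
    2≤n : 2 ≤ n
    2≤n = ≤-trans (≤-trans (toWitness {a? = 2 ≤? 22} _) 22≤k) k≤n

  4dn≤2^k : 4 * d * n ≤ 2 ^ k
  4dn≤2^k = begin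
    4 * d * n         ≤⟨ *-mono-≤ (*-monoʳ-≤ 4 d≤k) n≤9k ⟩
    4 * k * (9 * k)   ≡⟨ solve List.[ k ] ⟩
    36 * (k * k)      ≤⟨ *-monoˡ-≤ (k * k) (toWitness {a? = 36 ≤? 64} _) ⟩
    64 * (k * k)      ≤⟨ 64n²≤2^n k (≤-trans (toWitness {a? = 20 ≤? 22} _) 22≤k) ⟩
    2 ^ k             ∎

  X : ℕ
  X = 2 ^ n * 2 ^ n * (2 ^ n) ^ k

  summand≤X : ∀ q c → c ≤ k → summand n q c ≤ X
  summand≤X q c c≤k = *-mono-≤ (*-mono-≤ (C≤2^ n q) (≤-trans (C≤2^ (n ∸ q) c) (^-monoʳ-≤ 2 (m∸n≤m n q))))
    (begin
      (2 ^ (n ∸ c ∸ q) ∸ 1) ^ c  ≤⟨ ^-monoˡ-≤ c (≤-trans (m∸n≤m _ 1) (^-monoʳ-≤ 2 (≤-trans (m∸n≤m (n ∸ c) q) (m∸n≤m n c)))) ⟩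
      (2 ^ n) ^ c                ≤⟨ ^-monoʳ-≤ (2 ^ n) {{m^n≢0 2 n}} c≤k ⟩
      (2 ^ n) ^ k                ∎)

  2^[5k]^[2k]≤summand : (2 ^ (5 * k)) ^ (2 * k) ≤ summand n 2 (2 * k)
  2^[5k]^[2k]≤summand = begin
    (2 ^ (5 * k)) ^ (2 * k)   ≤⟨ ^-monoˡ-≤ (2 * k) 2^[5k]≤ ⟩
    Y                         ≡⟨ sym (*-identityˡ Y) ⟩
    1 * 1 * Y                 ≤⟨ *-monoˡ-≤ Y (*-mono-≤ (C>0 2≤n) (C>0 2k≤n∸2)) ⟩
    summand n 2 (2 * k)       ∎
    where
    Y : ℕ
    Y = (2 ^ (n ∸ 2 * k ∸ 2) ∸ 1) ^ (2 * k)
    2k≤n∸2 : 2 * k ≤ n ∸ 2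
    2k≤n∸2 = m+n≤o⇒m≤o∸n (2 * k) (begin
      2 * k + 2  ≤⟨ +-monoʳ-≤ (2 * k) (≤-trans (n≤1+n 2) 3≤k) ⟩
      2 * k + k  ≡⟨ solve List.[ k ] ⟩
      3 * k      ≤⟨ *-monoˡ-≤ k (toWitness {a? = 3 ≤? 8} _) ⟩
      8 * k      ≤⟨ 8k≤n ⟩
      n          ∎)
    5k+1≤ : 5 * k + 1 ≤ n ∸ 2 * k ∸ 2
    5k+1≤ = subst (5 * k + 1 ≤_) (sym (∸-+-assoc n (2 * k) 2)) (m+n≤o⇒m≤o∸n (5 * k + 1) (begin
      5 * k + 1 + (2 * k + 2)  ≡⟨ solve List.[ k ] ⟩
      7 * k + 3                ≤⟨ +-monoʳ-≤ (7 * k) 3≤k ⟩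
      7 * k + k                ≡⟨ solve List.[ k ] ⟩
      8 * k                    ≤⟨ 8k≤n ⟩
      n                        ∎))
    2^[5k]≤ : 2 ^ (5 * k) ≤ 2 ^ (n ∸ 2 * k ∸ 2) ∸ 1
    2^[5k]≤ = m+n≤o⇒m≤o∸n (2 ^ (5 * k)) (begin
      2 ^ (5 * k) + 1              ≤⟨ +-monoʳ-≤ (2 ^ (5 * k)) (m^n>0 2 (5 * k)) ⟩
      2 ^ (5 * k) + 2 ^ (5 * k)    ≡⟨ cong (2 ^ (5 * k) +_) (sym (+-identityʳ _)) ⟩
      2 ^ suc (5 * k)              ≡⟨ cong (2 ^_) (+-comm 1 (5 * k)) ⟩
      2 ^ (5 * k + 1)              ≤⟨ ^-monoʳ-≤ 2 5k+1≤ ⟩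
      2 ^ (n ∸ 2 * k ∸ 2)          ∎)

  2dnkX≤2^[5k]^[2k] : 2 * d * (n * (k * X)) ≤ (2 ^ (5 * k)) ^ (2 * k)
  2dnkX≤2^[5k]^[2k] = begin
    2 * d * (n * (k * X))                          ≡⟨ regroup d n k X ⟩
    2 * d * n * k * X                              ≤⟨ *-mono-≤ 2dnk≤ X≤ ⟩
    2 ^ (5 + 3 * k) * 2 ^ (18 * k + 9 * (k * k))   ≡⟨ sym (^-distribˡ-+-* 2 (5 + 3 * k) _) ⟩
    2 ^ (5 + 3 * k + (18 * k + 9 * (k * k)))       ≤⟨ ^-monoʳ-≤ 2 exponent≤ ⟩
    2 ^ (5 * k * (2 * k))                          ≡⟨ sym (^-*-assoc 2 (5 * k) (2 * k)) ⟩
    (2 ^ (5 * k)) ^ (2 * k)                        ∎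
    where
    regroup : ∀ d n k X → 2 * d * (n * (k * X)) ≡ 2 * d * n * k * X
    regroup = solve-∀
    thrice : ∀ k → k + k + k ≡ 3 * k
    thrice = solve-∀
    collect : ∀ k → 9 * k + 9 * k + 9 * k * k ≡ 18 * k + 9 * (k * k)
    collect = solve-∀
    k≤2^k : k ≤ 2 ^ k
    k≤2^k = <⇒≤ (n<2^n k)
    2dnk≤ : 2 * d * n * k ≤ 2 ^ (5 + 3 * k)
    2dnk≤ = begin
      2 * d * n * k                     ≤⟨ *-monoˡ-≤ k (*-mono-≤ (*-monoʳ-≤ 2 d≤k) n≤9k) ⟩
      2 * k * (9 * k) * k               ≡⟨ solve List.[ k ] ⟩
      18 * (k * k * k)                  ≤⟨ *-mono-≤ (toWitness {a? = 18 ≤? 32} _) (*-mono-≤ (*-mono-≤ k≤2^k k≤2^k) k≤2^k) ⟩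
      32 * (2 ^ k * 2 ^ k * 2 ^ k)      ≡⟨ cong (32 *_) (sym (trans (^-distribˡ-+-* 2 (k + k) k) (cong (_* 2 ^ k) (^-distribˡ-+-* 2 k k)))) ⟩
      2 ^ 5 * 2 ^ (k + k + k)           ≡⟨ sym (^-distribˡ-+-* 2 5 (k + k + k)) ⟩
      2 ^ (5 + (k + k + k))             ≡⟨ cong (λ m → 2 ^ (5 + m)) (thrice k) ⟩
      2 ^ (5 + 3 * k)                   ∎
    2^n≤ : 2 ^ n ≤ 2 ^ (9 * k)
    2^n≤ = ^-monoʳ-≤ 2 n≤9k
    X≤ : X ≤ 2 ^ (18 * k + 9 * (k * k))
    X≤ = begin
      2 ^ n * 2 ^ n * (2 ^ n) ^ k                   ≤⟨ *-mono-≤ (*-mono-≤ 2^n≤ 2^n≤) (^-monoˡ-≤ k 2^n≤) ⟩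
      2 ^ (9 * k) * 2 ^ (9 * k) * (2 ^ (9 * k)) ^ k  ≡⟨ cong₂ _*_ (sym (^-distribˡ-+-* 2 (9 * k) (9 * k))) (^-*-assoc 2 (9 * k) k) ⟩
      2 ^ (9 * k + 9 * k) * 2 ^ (9 * k * k)          ≡⟨ sym (^-distribˡ-+-* 2 (9 * k + 9 * k) (9 * k * k)) ⟩
      2 ^ (9 * k + 9 * k + 9 * k * k)                ≡⟨ cong (2 ^_) (collect k) ⟩
      2 ^ (18 * k + 9 * (k * k))                     ∎
    exponent≤ : 5 + 3 * k + (18 * k + 9 * (k * k)) ≤ 5 * k * (2 * k)
    exponent≤ = begin
      5 + 3 * k + (18 * k + 9 * (k * k))   ≡⟨ solve List.[ k ] ⟩
      5 + 21 * k + 9 * (k * k)             ≤⟨ +-monoˡ-≤ (9 * (k * k)) (5+21n≤n² k 22≤k) ⟩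
      k * k + 9 * (k * k)                  ≡⟨ solve List.[ k ] ⟩
      5 * k * (2 * k)                      ∎

  row low high : ℕ → ℕ
  row q = ∑[ c < suc n ] summand n q c
  low q = ∑[ c < k ] summand n q c
  high q = ∑[ i < suc n ∸ k ] summand n q (k + i)

  row≡low+high : ∀ q → row q ≡ low q + high q
  row≡low+high q = trans (cong (λ m → ∑ m (summand n q)) (sym (m+[n∸m]≡n (≤-trans k≤n (n≤1+n n)))))
                         (∑-split k (suc n ∸ k) (summand n q))

  rowSum≤row : ∀ q → rowSum n q ≤ row q
  rowSum≤row q = subst (_≤ row q) (sym (sumFromTo≡∑ 0 (n ∸ q) (summand n q))) (∑-prefix (summand n q) (s≤s (m∸n≤m n q)))

  row2≤rowSum2 : row 2 ≤ rowSum n 2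
  row2≤rowSum2 = ≤-reflexive (begin-equality
    row 2                                   ≡⟨ cong (λ m → ∑ m (summand n 2)) (sym (cong suc (trans (+-comm (n ∸ 2) 2) (m+[n∸m]≡n 2≤n)))) ⟩
    ∑ (suc (n ∸ 2) + 2) (summand n 2)       ≡⟨ ∑-vanishing (suc (n ∸ 2)) 2 (summand n 2) (λ i → summand-vanishes n 2 _ (s≤s (m≤m+n (n ∸ 2) i))) ⟩
    ∑ (suc (n ∸ 2)) (summand n 2)           ≡⟨ sym (sumFromTo≡∑ 0 (n ∸ 2) (summand n 2)) ⟩
    rowSum n 2                              ∎)

  high-ratio : ∀ q → high (suc q) * (4 * d) ≤ high q
  high-ratio q = begin
    high (suc q) * (4 * d)                                   ≡⟨ ∑-*ʳ (suc n ∸ k) (λ i → summand n (suc q) (k + i)) (4 * d) ⟩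
    ∑[ i < suc n ∸ k ] (summand n (suc q) (k + i) * (4 * d))  ≤⟨ ∑-mono (suc n ∸ k) (λ i → summand-ratio-4d n d q (k + i) {{n≢0}}
                                                                    (≤-trans 4dn≤2^k (^-monoʳ-≤ 2 (m≤m+n k i)))) ⟩
    high q                                                   ∎
    where
    n≢0 : NonZero n
    n≢0 = >-nonZero (≤-trans (s≤s z≤n) 2≤n)

  high-halving : ∀ q → high (suc q) * 2 ≤ high q
  high-halving q = ≤-trans (*-monoʳ-≤ (high (suc q)) (≤-trans (toWitness {a? = 2 ≤? 4} _) (*-monoʳ-≤ 4 1≤d))) (high-ratio q)

  low≤kX : ∀ q → low q ≤ k * X
  low≤kX q = ∑-≤-* k (summand n q) λ c c<k → summand≤X q c (<⇒≤ c<k)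

  row2-dominates-low : 2 * d * (n * (k * X)) ≤ rowSum n 2
  row2-dominates-low = begin
    2 * d * (n * (k * X))     ≤⟨ 2dnkX≤2^[5k]^[2k] ⟩
    (2 ^ (5 * k)) ^ (2 * k)   ≤⟨ 2^[5k]^[2k]≤summand ⟩
    summand n 2 (2 * k)       ≤⟨ term≤∑ (suc n) (summand n 2) (s≤s 2k≤n) ⟩
    row 2                     ≤⟨ row2≤rowSum2 ⟩
    rowSum n 2                ∎
    where
    2k≤n : 2 * k ≤ n
    2k≤n = ≤-trans (*-monoˡ-≤ k (toWitness {a? = 2 ≤? 8} _)) 8k≤n

  row2-dominates-high : ∀ {a} → 3 ≤ a → high a * (4 * d) ≤ rowSum n 2
  row2-dominates-high {suc a} (s≤s 2≤a) = begin
    high (suc a) * (4 * d)  ≤⟨ high-ratio a ⟩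
    high a                  ≤⟨ antitone high (λ q → ≤-trans (m≤m*n (high (suc q)) 2) (high-halving q)) 2≤a ⟩
    high 2                  ≤⟨ m≤n+m (high 2) (low 2) ⟩
    low 2 + high 2          ≡⟨ sym (row≡low+high 2) ⟩
    row 2                   ≤⟨ row2≤rowSum2 ⟩
    rowSum n 2              ∎

  tail≤ : ∀ a b → 3 ≤ a → b ≤ n → ∑[ i < b ] rowSum n (a + i) * d ≤ rowSum n 2
  tail≤ a b 3≤a b≤n = *-cancelˡ-≤ 2 (begin
    2 * (S * d)                                        ≡⟨ double S d ⟩
    S * (2 * d)                                        ≤⟨ *-monoˡ-≤ (2 * d) S≤ ⟩
    (n * (k * X) + 2 * high a) * (2 * d)               ≡⟨ expand (n * (k * X)) (high a) d ⟩
    2 * d * (n * (k * X)) + high a * (4 * d)           ≤⟨ +-mono-≤ row2-dominates-low (row2-dominates-high 3≤a) ⟩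
    rowSum n 2 + rowSum n 2                            ≡⟨ cong (rowSum n 2 +_) (sym (+-identityʳ (rowSum n 2))) ⟩
    2 * rowSum n 2                                     ∎)
    where
    double : ∀ S d → 2 * (S * d) ≡ S * (2 * d)
    double = solve-∀
    expand : ∀ x h d → (x + 2 * h) * (2 * d) ≡ 2 * d * x + h * (4 * d)
    expand = solve-∀
    S : ℕ
    S = ∑[ i < b ] rowSum n (a + i)
    S≤ : S ≤ n * (k * X) + 2 * high a
    S≤ = begin
      S                                                        ≤⟨ ∑-mono b (λ i → ≤-trans (rowSum≤row (a + i)) (≤-reflexive (row≡low+high (a + i)))) ⟩
      ∑[ i < b ] (low (a + i) + high (a + i))                  ≡⟨ ∑-+ b (low ∘ (a +_)) (high ∘ (a +_)) ⟩
      ∑[ i < b ] low (a + i) + ∑[ i < b ] high (a + i)          ≤⟨ +-mono-≤ (≤-trans (∑-≤-* b (low ∘ (a +_)) (λ i _ → low≤kX (a + i))) (*-monoˡ-≤ (k * X) b≤n))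
                                                                             (∑-geometric high high-halving a b) ⟩
      n * (k * X) + 2 * high a                                 ∎

-- The truncated sum

head-dominates : ∀ {S T p d} → T * d ≤ S → 1 ≤ p → p ≤ d → (S + T) * (d ∸ p) ≤ S * d
head-dominates {S} {T} {p} {d} Td≤S 1≤p p≤d = begin
  (S + T) * (d ∸ p)          ≡⟨ *-distribʳ-+ (d ∸ p) S T ⟩
  S * (d ∸ p) + T * (d ∸ p)  ≤⟨ +-monoʳ-≤ (S * (d ∸ p)) (≤-trans (*-monoʳ-≤ T (m∸n≤m d p)) Td≤S) ⟩
  S * (d ∸ p) + S            ≤⟨ +-monoʳ-≤ (S * (d ∸ p)) (≤-trans (≤-reflexive (sym (*-identityʳ S))) (*-monoʳ-≤ S 1≤p)) ⟩
  S * (d ∸ p) + S * p        ≡⟨ sym (*-distribˡ-+ S (d ∸ p) p) ⟩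
  S * (d ∸ p + p)            ≡⟨ cong (S *_) (m∸n+n≡m p≤d) ⟩
  S * d                      ∎

eighth : ∀ {m n} → 8 ≤ m → 8 * m ≤ n → ∃ λ k → m ≤ k × 8 * k ≤ n × n ≤ 9 * k
eighth {m} {n} 8≤m 8m≤n = k , m≤k , subst (_≤ n) (*-comm k 8) (m/n*n≤m n 8) , n≤9k
  where
  k : ℕ
  k = n / 8
  n<8[k+1] : n < suc k * 8
  n<8[k+1] = subst (_< suc k * 8) (sym (m≡m%n+[m/n]*n n 8)) (+-monoˡ-< (k * 8) (m%n<n n 8))
  m≤k : m ≤ k
  m≤k = ≤-pred (*-cancelʳ-< _ m (suc k) (≤-trans (s≤s (subst (_≤ n) (*-comm 8 m) 8m≤n)) n<8[k+1]))
  unfold : ∀ k → suc k * 8 ≡ 8 * k + 8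
  unfold = solve-∀
  collect : ∀ k → 8 * k + k ≡ 9 * k
  collect = solve-∀
  n≤9k : n ≤ 9 * k
  n≤9k = begin
    n            ≤⟨ <⇒≤ n<8[k+1] ⟩
    suc k * 8    ≡⟨ unfold k ⟩
    8 * k + 8    ≤⟨ +-monoʳ-≤ (8 * k) (≤-trans 8≤m m≤k) ⟩
    8 * k + k    ≡⟨ collect k ⟩
    9 * k        ∎

approx-split : ∀ s n → s < n ∸ 1 →
  approx n n ≡ approx (suc s) n + 2 * ∑[ i < n ∸ 1 ∸ 1 ∸ s ] rowSum n (2 + s + i)
approx-split s n s<n-1 = begin-equality
  approx n n
    ≡⟨ cong (λ m → 2 * sumFromTo 2 m (rowSum n)) (m≥n⇒m⊓n≡n (m∸n≤m n 1)) ⟩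
  2 * sumFromTo 2 (n ∸ 1) (rowSum n)
    ≡⟨ cong (2 *_) (sumFromTo≡∑ 2 (n ∸ 1) (rowSum n)) ⟩
  2 * ∑[ i < n ∸ 1 ∸ 1 ] rowSum n (2 + i)
    ≡⟨ cong (λ m → 2 * ∑[ i < m ] rowSum n (2 + i)) (sym (m+[n∸m]≡n s≤n-2)) ⟩
  2 * ∑[ i < s + (n ∸ 1 ∸ 1 ∸ s) ] rowSum n (2 + i)
    ≡⟨ cong (2 *_) (∑-split s _ (λ i → rowSum n (2 + i))) ⟩
  2 * (∑[ i < s ] rowSum n (2 + i) + T)
    ≡⟨ *-distribˡ-+ 2 (∑[ i < s ] rowSum n (2 + i)) T ⟩
  2 * ∑[ i < s ] rowSum n (2 + i) + 2 * T
    ≡⟨ cong (λ m → 2 * m + 2 * T) (sym (sumFromTo≡∑ 2 (suc s) (rowSum n))) ⟩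
  2 * sumFromTo 2 (suc s) (rowSum n) + 2 * T
    ≡⟨ cong (λ m → 2 * sumFromTo 2 m (rowSum n) + 2 * T) (sym (m≤n⇒m⊓n≡m s<n-1)) ⟩
  approx (suc s) n + 2 * T ∎
  where
  T : ℕ
  T = ∑[ i < n ∸ 1 ∸ 1 ∸ s ] rowSum n (2 + s + i)
  s≤n-2 : s ≤ n ∸ 1 ∸ 1
  s≤n-2 = ∸-monoˡ-≤ 1 s<n-1

tail-bound : ∀ {d n} → 1 ≤ d → 8 * (22 + d) ≤ n → ∀ a len → 3 ≤ a → len ≤ n →
             ∑[ i < len ] rowSum n (a + i) * d ≤ rowSum n 2
tail-bound {d} {n} 1≤d n-large =
  let (k , 22+d≤k , 8k≤n , n≤9k) = eighth {22 + d} (m≤m+n 8 (14 + d)) n-large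
  in Estimates.tail≤ d n k 1≤d (≤-trans (m≤m+n 22 d) 22+d≤k) (≤-trans (m≤n+m d 22) 22+d≤k) 8k≤n n≤9k

approx-bounds : ∀ p d s n → 1 ≤ p → p < d → 2 ≤ s → 8 * (22 + d) ≤ n →
                approx s n ≤ approx n n × approx n n * (d ∸ p) ≤ approx s n * d
approx-bounds p d (suc s) n 1≤p p<d (s≤s 1≤s) n-large with s <? n ∸ 1
... | no s≮n-1 = ≤-reflexive same , (begin
  approx n n * (d ∸ p)    ≤⟨ *-monoʳ-≤ (approx n n) (m∸n≤m d p) ⟩
  approx n n * d          ≡⟨ cong (_* d) (sym same) ⟩
  approx (suc s) n * d    ∎)
  where
  same : approx (suc s) n ≡ approx n n
  same = cong (λ m → 2 * sumFromTo 2 m (rowSum n))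
              (trans (m≥n⇒m⊓n≡n (≤-trans (≮⇒≥ s≮n-1) (n≤1+n s))) (sym (m≥n⇒m⊓n≡n (m∸n≤m n 1))))
... | yes s<n-1 = (begin
  2 * H            ≤⟨ m≤m+n (2 * H) (2 * T) ⟩
  2 * H + 2 * T    ≡⟨ sym split ⟩
  approx n n       ∎) , (begin
  approx n n * (d ∸ p)           ≡⟨ cong (_* (d ∸ p)) split ⟩
  (2 * H + 2 * T) * (d ∸ p)      ≡⟨ factor-2 H T (d ∸ p) ⟩
  2 * ((H + T) * (d ∸ p))        ≤⟨ *-monoʳ-≤ 2 (head-dominates Td≤H 1≤p (<⇒≤ p<d)) ⟩
  2 * (H * d)                    ≡⟨ sym (*-assoc 2 H d) ⟩
  2 * H * d                      ∎)
  where
  factor-2 : ∀ h t e → (2 * h + 2 * t) * e ≡ 2 * ((h + t) * e)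
  factor-2 = solve-∀
  H len T : ℕ
  H = sumFromTo 2 (suc s ⊓ (n ∸ 1)) (rowSum n)
  len = n ∸ 1 ∸ 1 ∸ s
  T = ∑[ i < len ] rowSum n (2 + s + i)
  split : approx n n ≡ 2 * H + 2 * T
  split = approx-split s n s<n-1
  rowSum2≤H : rowSum n 2 ≤ H
  rowSum2≤H = begin
    rowSum n 2                       ≤⟨ term≤∑ s (λ i → rowSum n (2 + i)) 1≤s ⟩
    ∑[ i < s ] rowSum n (2 + i)      ≡⟨ sym (sumFromTo≡∑ 2 (suc s) (rowSum n)) ⟩
    sumFromTo 2 (suc s) (rowSum n)   ≡⟨ cong (λ m → sumFromTo 2 m (rowSum n)) (sym (m≤n⇒m⊓n≡m s<n-1)) ⟩
    H                                ∎
  Td≤H : T * d ≤ H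
  Td≤H = ≤-trans (tail-bound (≤-trans 1≤p (<⇒≤ p<d)) n-large (2 + s) len (s≤s (s≤s 1≤s))
                              (≤-trans (m∸n≤m _ s) (≤-trans (m∸n≤m _ 1) (m∸n≤m n 1))))
                 rowSum2≤H

-- N depends only on d, and of the property defining s only 2 ≤ s is needed.
lemma7p12 : (p d : ℕ) → 0 < p → p < d → (s : ℕ) → IsS p d s →
    ∃ λ N → (n : ℕ) → N ≤ n →
      ∃ λ B → Count (Target n) B × (B * (d ∸ p) ≤ approx s n * d) × (approx s n ≤ B)
lemma7p12 p d 0<p p<d s ((37≤s , _) , _) = 8 * (22 + d) , λ n n-large →
  let (approx≤ , ratio) = approx-bounds p d s n 0<p p<d 2≤s n-large
  in approx n n , Count-target n , ratio , approx≤
  where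
  2≤s : 2 ≤ s
  2≤s = ≤-trans (toWitness {a? = 2 ≤? 37} _) 37≤s
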